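{- For all integers $q\geq 3$ and $b\geq 1$ there exist $\varepsilon_0>0$ and $C_0>0$ such that for all $0<\varepsilon\leq\varepsilon_0$ and $C\geq C_0$ the following holds. Let $G$ be an $n$-vertex graph with $\delta(G)\geq(1-\varepsilon)n$. If $\mathcal{H}$ is a $q$-uniform hypergraph with vertex set $V(G)$ such that $\Delta_1(\mathcal{H})\leq n/C$, then there exists a probability distribution on families $(T_e:e\in E(\mathcal{H}))$ of pairwise edge-disjoint subgraphs of $G$, where each $T_e$ is a partial $K_{q+b}$ rooted at $e$ (viewed as a vertex set), such that $\Delta(T)\leq C\Delta_1(\mathcal{H})$ where $T:=\bigcup_{e\in E(\mathcal{H})}T_e$, and such that for every family $(S_e\subseteq V(G):e\in E(\mathcal{H}))$, $$\mathbb{P}\big[S_e\subseteq V(T_e)\setminus e \text{ for all } e\in E(\mathcal{H})\big]\leq\left(\frac{(3b)^b}{n}\right)^{\sum_{e\in E(\mathcal{H})}|S_e|}.$$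
   Context: A partial $K_k$ rooted at $R$ is a graph $T$ with $R\subseteq V(T)$, $|V(T)|=k$, and $E(T)=\binom{V(T)}{2}\setminus\binom{R}{2}$. For a hypergraph $\mathcal{H}$, $\Delta_1(\mathcal{H})$ denotes the maximum number of edges of $\mathcal{H}$ containing a given vertex.
   Formalization: The parameters ε and C range over the rationals instead of the reals, the constants ε₀ and C₀ are taken rational, and the probability distribution on families has rational weights. -}

module Defs where

open import Data.Bool using (Bool; true; false; _∧_; not)
open import Data.Nat using (ℕ; zero; suc; _⊔_)
open import Data.Fin using (Fin)
open import Data.Fin.Subset using (Subset; _∈_; _⊆_; _─_; ∣_∣; inside; outside)
open import Data.Fin.Subset.Properties using (_⊆?_)
open import Data.Fin.Properties using (all?)
open import Data.Vec using (Vec; tabulate; lookup)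
open import Data.List using (List; []; _∷_; allFin; map; foldr)
open import Data.List.Relation.Unary.All using (All)
open import Data.Product using (_×_; _,_; Σ)
open import Data.Integer using (+_)
open import Data.Rational using (ℚ; _/_; _+_; 0ℚ)
open import Relation.Binary.PropositionalEquality using (_≡_; _≢_)
open import Relation.Nullary using (¬_; does)
open import Function using (_⇔_)

⟦_⟧ : ℕ → ℚ
⟦ n ⟧ = + n / 1

maxF : ∀ {n} → (Fin n → ℕ) → ℕ
maxF {n} f = foldr _⊔_ 0 (map f (allFin n))

record Graph (n : ℕ) : Set where
  field
    adj    : Fin n → Fin n → Bool
    sym    : ∀ x y → adj x y ≡ adj y x
    irrefl : ∀ x → adj x x ≡ false
open Graph public

degOf : ∀ {n} → (Fin n → Fin n → Bool) → Fin n → ℕ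
degOf a v = ∣ tabulate (λ u → if-b (a v u)) ∣
  where
  if-b : Bool → Data.Fin.Subset.Side
  if-b true  = inside
  if-b false = outside

maxDeg : ∀ {n} → (Fin n → Fin n → Bool) → ℕ
maxDeg a = maxF (degOf a)

record Hypergraph (q n : ℕ) : Set where
  field
    m        : ℕ
    edge     : Fin m → Subset n
    uniform  : ∀ i → ∣ edge i ∣ ≡ q
    distinct : ∀ i j → edge i ≡ edge j → i ≡ j
open Hypergraph public

Δ₁ : ∀ {q n} → Hypergraph q n → ℕ
Δ₁ H = maxF (λ v → ∣ tabulate (λ i → lookup (edge H i) v) ∣)

record SubG (n : ℕ) : Set where
  field
    verts : Subset n
    adjT  : Fin n → Fin n → Bool
open SubG public

IsPartialK : ∀ {n} → ℕ → Subset n → SubG n → Set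
IsPartialK k R T =
  R ⊆ verts T × ∣ verts T ∣ ≡ k ×
  (∀ x y → (adjT T x y ≡ true) ⇔
           (x ∈ verts T × y ∈ verts T × x ≢ y × ¬ (x ∈ R × y ∈ R)))

IsSubgraph : ∀ {n} → SubG n → Graph n → Set
IsSubgraph T G = ∀ x y → adjT T x y ≡ true → adj G x y ≡ true

Family : ℕ → ℕ → Set
Family m n = Fin m → SubG n

unionAdj : ∀ {m n} → Family m n → Fin n → Fin n → Bool
unionAdj {m} F x y = foldr _∨_ false (map (λ i → adjT (F i) x y) (allFin m))
  where open import Data.Bool using (_∨_)

ValidFamily : ∀ {q n} → ℕ → Graph n → (H : Hypergraph q n) → Family (m H) n → Set
ValidFamily {q} b G H F =
  (∀ i → IsPartialK (q Data.Nat.+ b) (edge H i) (F i) × IsSubgraph (F i) G) ×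
  (∀ i j → i ≢ j → ∀ x y → ¬ (adjT (F i) x y ≡ true × adjT (F j) x y ≡ true))

weightSum : ∀ {A : Set} → List (ℚ × A) → ℚ
weightSum = foldr (λ { (p , _) s → p + s }) 0ℚ

record Dist (A : Set) : Set where
  field
    support : List (ℚ × A)
    nonneg  : All (λ pa → 0ℚ Data.Rational.≤ Data.Product.proj₁ pa) support
    total   : weightSum support ≡ Data.Rational.1ℚ
open Dist public

Pr : ∀ {A : Set} → Dist A → (A → Bool) → ℚ
Pr D ev = foldr (λ { (p , a) s → if ev a then p + s else s }) 0ℚ (support D)
  where open import Data.Bool using (if_then_else_)

Event : ∀ {q n} (H : Hypergraph q n) → (Fin (m H) → Subset n) → Family (m H) n → Bool
Event H S F = does (all? (λ i → S i ⊆? (verts (F i) ─ edge H i)))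

totalSize : ∀ {m n} → (Fin m → Subset n) → ℕ
totalSize {m} S = foldr Data.Nat._+_ 0 (map (λ i → ∣ S i ∣) (allFin m))

{-# OPTIONS --safe #-}
module Submission where

-- The edges e of H are processed in turn; e is extended by b new
-- vertices, each chosen uniformly among the first A ≈ n/3 vertices that are joined to e and to the
-- vertices already chosen for it by edges of G not used by earlier cliques, and whose used degree is
-- still below D = 10(q+b)²Δ₁(H). The minimum degree of G and a degree-budget invariant show that at
-- most 3n/10 vertices are ever excluded, so every step has exactly A options and all A^(b|E(H)|)
-- runs are equally likely. Of the A^b ways to extend e, at most b^|S_e| A^(b-|S_e|) cover S_e, so
-- the probability that S_e ⊆ V(T_e) ∖ e for all e is at most (b/A)^Σ|S_e| ≤ (3b/n)^Σ|S_e|.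

module FinCounting where
  open import Data.Bool using (Bool; true; false; _∧_; _∨_; not; T)
  open import Data.Bool.Properties using (∨-conicalˡ; ∨-conicalʳ; ∧-identityʳ)
  open import Data.Fin using (Fin; zero; suc)
  import Data.Fin as Fin
  open import Data.Nat
  open import Data.Nat.Properties
  open import Data.Nat.Tactic.RingSolver using (solve-∀)
  open import Data.Product using (Σ; _,_)
  open import Function using (_∘_)
  open import Relation.Binary.PropositionalEquality
  open import Relation.Nullary using (does; yes; no; ¬_; contradiction)

  𝟙 : Bool → ℕ
  𝟙 true = 1
  𝟙 false = 0

  count : ∀ {n} → (Fin n → Bool) → ℕ
  count {zero} f = 0
  count {suc n} f = 𝟙 (f zero) + count (f ∘ suc)

  ∑ : ∀ {n} → (Fin n → ℕ) → ℕ
  ∑ {zero} f = 0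
  ∑ {suc n} f = f zero + ∑ (f ∘ suc)

  anyᶠ : ∀ {n} → (Fin n → Bool) → Bool
  anyᶠ {zero} f = false
  anyᶠ {suc n} f = f zero ∨ anyᶠ (f ∘ suc)

  allᶠ : ∀ {n} → (Fin n → Bool) → Bool
  allᶠ {zero} f = true
  allᶠ {suc n} f = f zero ∧ allᶠ (f ∘ suc)

  _≟ᵇ_ : ∀ {n} → Fin n → Fin n → Bool
  x ≟ᵇ y = does (x Fin.≟ y)

  ≟ᵇ-refl : ∀ {n} (x : Fin n) → (x ≟ᵇ x) ≡ true
  ≟ᵇ-refl x with x Fin.≟ x
  ... | yes _ = refl
  ... | no x≢x = contradiction refl x≢x

  ≟ᵇ⇒≡ : ∀ {n} {x y : Fin n} → (x ≟ᵇ y) ≡ true → x ≡ y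
  ≟ᵇ⇒≡ {x = x} {y} _ with x Fin.≟ y
  ... | yes x≡y = x≡y

  ≢⇒≟ᵇ : ∀ {n} {x y : Fin n} → ¬ x ≡ y → (x ≟ᵇ y) ≡ false
  ≢⇒≟ᵇ {x = x} {y} x≢y with x Fin.≟ y
  ... | yes x≡y = contradiction x≡y x≢y
  ... | no _ = refl

  ≟ᵇ-sym : ∀ {n} (x y : Fin n) → (x ≟ᵇ y) ≡ (y ≟ᵇ x)
  ≟ᵇ-sym x y with x Fin.≟ y | y Fin.≟ x
  ... | yes _ | yes _ = refl
  ... | no _ | no _ = refl
  ... | yes x≡y | no y≢x = contradiction (sym x≡y) y≢x
  ... | no x≢y | yes y≡x = contradiction (sym y≡x) x≢y

  ≟ᵇ-suc : ∀ {n} (x y : Fin n) → (suc x ≟ᵇ suc y) ≡ (x ≟ᵇ y)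
  ≟ᵇ-suc x y with x Fin.≟ y
  ... | yes refl = refl
  ... | no _ = refl

  𝟙≤1 : ∀ a → 𝟙 a ≤ 1
  𝟙≤1 true = ≤-refl
  𝟙≤1 false = z≤n

  𝟙-mono : ∀ {a b} → (a ≡ true → b ≡ true) → 𝟙 a ≤ 𝟙 b
  𝟙-mono {true} a⇒b rewrite a⇒b refl = ≤-refl
  𝟙-mono {false} _ = z≤n

  𝟙-∨ : ∀ a b → 𝟙 (a ∨ b) ≤ 𝟙 a + 𝟙 b
  𝟙-∨ true b = s≤s z≤n
  𝟙-∨ false b = ≤-refl

  𝟙-∨-disjoint : ∀ a b → a ∧ b ≡ false → 𝟙 (a ∨ b) ≡ 𝟙 a + 𝟙 b
  𝟙-∨-disjoint true false _ = refl
  𝟙-∨-disjoint false b _ = refl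

  𝟙-not : ∀ a → 𝟙 a + 𝟙 (not a) ≡ 1
  𝟙-not true = refl
  𝟙-not false = refl

  private
    interchange : ∀ a b c d → (a + b) + (c + d) ≡ (a + c) + (b + d)
    interchange = solve-∀

  count-cong : ∀ {n} {f g : Fin n → Bool} → (∀ x → f x ≡ g x) → count f ≡ count g
  count-cong {zero} _ = refl
  count-cong {suc n} f≗g = cong₂ _+_ (cong 𝟙 (f≗g zero)) (count-cong (f≗g ∘ suc))

  count-false : ∀ n → count {n} (λ _ → false) ≡ 0
  count-false zero = refl
  count-false (suc n) = count-false n

  count-mono : ∀ {n} {f g : Fin n → Bool} → (∀ x → f x ≡ true → g x ≡ true) → count f ≤ count g
  count-mono {zero} _ = z≤n
  count-mono {suc n} f⇒g = +-mono-≤ (𝟙-mono (f⇒g zero)) (count-mono (f⇒g ∘ suc))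

  count-∨ : ∀ {n} (f g : Fin n → Bool) → count (λ x → f x ∨ g x) ≤ count f + count g
  count-∨ {zero} f g = z≤n
  count-∨ {suc n} f g = begin
    𝟙 (f zero ∨ g zero) + count (λ x → f (suc x) ∨ g (suc x))
      ≤⟨ +-mono-≤ (𝟙-∨ (f zero) (g zero)) (count-∨ (f ∘ suc) (g ∘ suc)) ⟩
    (𝟙 (f zero) + 𝟙 (g zero)) + (count (f ∘ suc) + count (g ∘ suc))
      ≡⟨ interchange (𝟙 (f zero)) _ _ _ ⟩
    count f + count g ∎
    where open ≤-Reasoning

  count-∨-disjoint : ∀ {n} (f g : Fin n → Bool) → (∀ x → f x ∧ g x ≡ false) →
    count (λ x → f x ∨ g x) ≡ count f + count g
  count-∨-disjoint {zero} f g _ = refl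
  count-∨-disjoint {suc n} f g disj = trans
    (cong₂ _+_ (𝟙-∨-disjoint (f zero) (g zero) (disj zero)) (count-∨-disjoint (f ∘ suc) (g ∘ suc) (disj ∘ suc)))
    (interchange (𝟙 (f zero)) _ _ _)

  count-not : ∀ {n} (f : Fin n → Bool) → count f + count (not ∘ f) ≡ n
  count-not {zero} f = refl
  count-not {suc n} f = trans (interchange (𝟙 (f zero)) _ _ _)
    (cong₂ _+_ (𝟙-not (f zero)) (count-not (f ∘ suc)))

  count>0⇒witness : ∀ {n} (f : Fin n → Bool) → 1 ≤ count f → Σ (Fin n) (λ x → f x ≡ true)
  count>0⇒witness {suc n} f pos with f zero in fz
  ... | true = zero , fz
  ... | false = let x , fx = count>0⇒witness (f ∘ suc) pos in suc x , fx

  _∖_ : ∀ {n} → (Fin n → Bool) → Fin n → (Fin n → Bool)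
  (f ∖ z) x = f x ∧ not (x ≟ᵇ z)

  count-remove : ∀ {n} (f : Fin n → Bool) z → f z ≡ true → count f ≡ suc (count (f ∖ z))
  count-remove {suc n} f zero fz rewrite fz =
    cong suc (count-cong (λ x → sym (∧-identityʳ (f (suc x)))))
  count-remove {suc n} f (suc z) fz = begin
    𝟙 (f zero) + count (f ∘ suc)
      ≡⟨ cong (𝟙 (f zero) +_) (count-remove (f ∘ suc) z fz) ⟩
    𝟙 (f zero) + suc (count ((f ∘ suc) ∖ z))
      ≡⟨ +-suc (𝟙 (f zero)) _ ⟩
    suc (𝟙 (f zero) + count ((f ∘ suc) ∖ z))
      ≡⟨ cong suc (cong₂ _+_ (cong 𝟙 (sym (∧-identityʳ (f zero))))
                             (count-cong (λ x → cong (λ b → f (suc x) ∧ not b) (sym (≟ᵇ-suc x z))))) ⟩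
    suc (count (f ∖ suc z)) ∎
    where open ≡-Reasoning

  count-singleton : ∀ {n} (z : Fin n) → count (_≟ᵇ z) ≡ 1
  count-singleton {n} z = begin
    count (_≟ᵇ z)                  ≡⟨ count-remove (_≟ᵇ z) z (≟ᵇ-refl z) ⟩
    suc (count ((_≟ᵇ z) ∖ z))      ≡⟨ cong suc (count-cong (λ x → contradictory (x ≟ᵇ z))) ⟩
    suc (count {n} (λ _ → false))  ≡⟨ cong suc (count-false n) ⟩
    1                              ∎
    where
    open ≡-Reasoning
    contradictory : ∀ a → a ∧ not a ≡ false
    contradictory true = refl
    contradictory false = refl

  ∑-cong : ∀ {n} {f g : Fin n → ℕ} → (∀ x → f x ≡ g x) → ∑ f ≡ ∑ g
  ∑-cong {zero} _ = refl
  ∑-cong {suc n} f≗g = cong₂ _+_ (f≗g zero) (∑-cong (f≗g ∘ suc))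

  ∑-mono : ∀ {n} {f g : Fin n → ℕ} → (∀ x → f x ≤ g x) → ∑ f ≤ ∑ g
  ∑-mono {zero} _ = z≤n
  ∑-mono {suc n} f≤g = +-mono-≤ (f≤g zero) (∑-mono (f≤g ∘ suc))

  ∑-+ : ∀ {n} (f g : Fin n → ℕ) → ∑ (λ x → f x + g x) ≡ ∑ f + ∑ g
  ∑-+ {zero} f g = refl
  ∑-+ {suc n} f g = trans (cong (f zero + g zero +_) (∑-+ (f ∘ suc) (g ∘ suc))) (interchange (f zero) _ _ _)

  ∑-*ˡ : ∀ {n} c (f : Fin n → ℕ) → ∑ (λ x → c * f x) ≡ c * ∑ f
  ∑-*ˡ {zero} c f = sym (*-zeroʳ c)
  ∑-*ˡ {suc n} c f = trans (cong (c * f zero +_) (∑-*ˡ c (f ∘ suc))) (sym (*-distribˡ-+ c (f zero) _))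

  ∑-const : ∀ {n} c → ∑ {n} (λ _ → c) ≡ n * c
  ∑-const {zero} c = refl
  ∑-const {suc n} c = cong (c +_) (∑-const {n} c)

  ∑-𝟙 : ∀ {n} (f : Fin n → Bool) → ∑ (𝟙 ∘ f) ≡ count f
  ∑-𝟙 {zero} f = refl
  ∑-𝟙 {suc n} f = cong (𝟙 (f zero) +_) (∑-𝟙 (f ∘ suc))

  ∑-𝟙* : ∀ {n} (f : Fin n → Bool) c → ∑ (λ x → 𝟙 (f x) * c) ≡ count f * c
  ∑-𝟙* {zero} f c = refl
  ∑-𝟙* {suc n} f c = trans (cong (𝟙 (f zero) * c +_) (∑-𝟙* (f ∘ suc) c)) (sym (*-distribʳ-+ c (𝟙 (f zero)) _))

  count-anyᶠ≤∑ : ∀ {n k} (h : Fin k → Fin n → Bool) → count (λ z → anyᶠ (λ x → h x z)) ≤ ∑ (count ∘ h)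
  count-anyᶠ≤∑ {n} {zero} h = ≤-reflexive (count-false n)
  count-anyᶠ≤∑ {n} {suc k} h = ≤-trans (count-∨ (h zero) (λ z → anyᶠ (λ x → h (suc x) z)))
    (+-monoʳ-≤ (count (h zero)) (count-anyᶠ≤∑ (h ∘ suc)))

  markov : ∀ {n} d (t : Fin n → ℕ) → count (λ z → d ≤ᵇ t z) * d ≤ ∑ t
  markov {zero} d t = z≤n
  markov {suc n} d t with d ≤ᵇ t zero in d≤t
  ... | true = +-mono-≤ (≤ᵇ⇒≤ d (t zero) (subst T (sym d≤t) _)) (markov d (t ∘ suc))
  ... | false = ≤-trans (markov d (t ∘ suc)) (m≤n+m _ _)

  anyᶠ-false : ∀ {n} (f : Fin n → Bool) → anyᶠ f ≡ false → ∀ x → f x ≡ false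
  anyᶠ-false {suc n} f none zero = ∨-conicalˡ _ _ none
  anyᶠ-false {suc n} f none (suc x) = anyᶠ-false (f ∘ suc) (∨-conicalʳ _ _ none) x

  allᶠ-true : ∀ {n} (f : Fin n → Bool) → (∀ x → f x ≡ true) → allᶠ f ≡ true
  allᶠ-true {zero} f _ = refl
  allᶠ-true {suc n} f all rewrite all zero = allᶠ-true (f ∘ suc) (all ∘ suc)

  allᶠ-elim : ∀ {n} (f : Fin n → Bool) → allᶠ f ≡ true → ∀ x → f x ≡ true
  allᶠ-elim {suc n} f all x with f zero in fz
  allᶠ-elim {suc n} f all zero | true = fz
  allᶠ-elim {suc n} f all (suc x) | true = allᶠ-elim (f ∘ suc) all x

  allᶠ-cong : ∀ {n} {f g : Fin n → Bool} → (∀ x → f x ≡ g x) → allᶠ f ≡ allᶠ g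
  allᶠ-cong {zero} _ = refl
  allᶠ-cong {suc n} f≗g = cong₂ _∧_ (f≗g zero) (allᶠ-cong (f≗g ∘ suc))

module ListCounting where
  open FinCounting
  open import Data.Bool using (Bool; true; false; _∧_; if_then_else_)
  open import Data.Bool.Properties using (∧-identityʳ)
  open import Data.Fin using (Fin; zero; suc)
  open import Data.List using (List; []; _∷_; _++_; length; map; concatMap)
  open import Data.List.Properties using (length-++)
  open import Data.List.Relation.Unary.All using (All; []; _∷_)
  open import Data.List.Relation.Unary.All.Properties using (map⁺)
  open import Data.Nat
  open import Data.Nat.Properties
  open import Data.Nat.Tactic.RingSolver using (solve-∀)
  open import Data.Product using (_×_; _,_)
  open import Function using (_∘_)
  open import Relation.Binary.PropositionalEquality

  private variable A B : Set

  countᴸ : (A → Bool) → List A → ℕ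
  countᴸ P [] = 0
  countᴸ P (x ∷ xs) = 𝟙 (P x) + countᴸ P xs

  sumᴸ : (A → ℕ) → List A → ℕ
  sumᴸ h [] = 0
  sumᴸ h (x ∷ xs) = h x + sumᴸ h xs

  countᴸ-++ : ∀ (P : A → Bool) xs ys → countᴸ P (xs ++ ys) ≡ countᴸ P xs + countᴸ P ys
  countᴸ-++ P [] ys = refl
  countᴸ-++ P (x ∷ xs) ys = trans (cong (𝟙 (P x) +_) (countᴸ-++ P xs ys)) (sym (+-assoc (𝟙 (P x)) _ _))

  countᴸ-concatMap : ∀ (P : B → Bool) (f : A → List B) xs →
    countᴸ P (concatMap f xs) ≡ sumᴸ (countᴸ P ∘ f) xs
  countᴸ-concatMap P f [] = refl
  countᴸ-concatMap P f (x ∷ xs) = trans (countᴸ-++ P (f x) _) (cong (countᴸ P (f x) +_) (countᴸ-concatMap P f xs))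

  length-concatMap : ∀ (f : A → List B) xs → length (concatMap f xs) ≡ sumᴸ (length ∘ f) xs
  length-concatMap f [] = refl
  length-concatMap f (x ∷ xs) = trans (length-++ (f x)) (cong (length (f x) +_) (length-concatMap f xs))

  countᴸ-map : ∀ (P : B → Bool) (g : A → B) xs → countᴸ P (map g xs) ≡ countᴸ (P ∘ g) xs
  countᴸ-map P g [] = refl
  countᴸ-map P g (x ∷ xs) = cong (𝟙 (P (g x)) +_) (countᴸ-map P g xs)

  countᴸ-cong : ∀ {P Q : A → Bool} {xs} → All (λ x → P x ≡ Q x) xs → countᴸ P xs ≡ countᴸ Q xs
  countᴸ-cong [] = refl
  countᴸ-cong (Px≡Qx ∷ eqs) = cong₂ _+_ (cong 𝟙 Px≡Qx) (countᴸ-cong eqs)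

  countᴸ-mono : ∀ {P Q : A → Bool} xs → (∀ x → P x ≡ true → Q x ≡ true) → countᴸ P xs ≤ countᴸ Q xs
  countᴸ-mono [] _ = z≤n
  countᴸ-mono (x ∷ xs) P⇒Q = +-mono-≤ (𝟙-mono (P⇒Q x)) (countᴸ-mono xs P⇒Q)

  countᴸ-true : ∀ (xs : List A) → countᴸ (λ _ → true) xs ≡ length xs
  countᴸ-true [] = refl
  countᴸ-true (x ∷ xs) = cong suc (countᴸ-true xs)

  countᴸ-∧ˡ : ∀ c (P : A → Bool) xs → countᴸ (λ x → c ∧ P x) xs ≡ 𝟙 c * countᴸ P xs
  countᴸ-∧ˡ true P xs = sym (+-identityʳ _)
  countᴸ-∧ˡ false P [] = refl
  countᴸ-∧ˡ false P (x ∷ xs) = countᴸ-∧ˡ false P xs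

  countᴸ-take : ∀ (P : A → Bool) k xs → countᴸ P (Data.List.take k xs) ≤ countᴸ P xs
  countᴸ-take P zero xs = z≤n
  countᴸ-take P (suc k) [] = z≤n
  countᴸ-take P (suc k) (x ∷ xs) = +-monoʳ-≤ (𝟙 (P x)) (countᴸ-take P k xs)

  sumᴸ-const : ∀ {h : A → ℕ} {c} {xs} → All (λ x → h x ≡ c) xs → sumᴸ h xs ≡ length xs * c
  sumᴸ-const [] = refl
  sumᴸ-const (hx≡c ∷ eqs) = cong₂ _+_ hx≡c (sumᴸ-const eqs)

  sumᴸ-mono : ∀ {f g : A → ℕ} xs → (∀ x → f x ≤ g x) → sumᴸ f xs ≤ sumᴸ g xs
  sumᴸ-mono [] _ = z≤n
  sumᴸ-mono (x ∷ xs) f≤g = +-mono-≤ (f≤g x) (sumᴸ-mono xs f≤g)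

  sumᴸ-*ʳ : ∀ (f : A → ℕ) c xs → sumᴸ (λ x → f x * c) xs ≡ sumᴸ f xs * c
  sumᴸ-*ʳ f c [] = refl
  sumᴸ-*ʳ f c (x ∷ xs) = trans (cong (f x * c +_) (sumᴸ-*ʳ f c xs)) (sym (*-distribʳ-+ c (f x) _))

  sumᴸ-𝟙* : ∀ (P : A → Bool) c xs → sumᴸ (λ x → 𝟙 (P x) * c) xs ≡ countᴸ P xs * c
  sumᴸ-𝟙* P c [] = refl
  sumᴸ-𝟙* P c (x ∷ xs) = trans (cong (𝟙 (P x) * c +_) (sumᴸ-𝟙* P c xs)) (sym (*-distribʳ-+ c (𝟙 (P x)) _))

  sumᴸ-split : ∀ (P : A → Bool) (h : A → ℕ) α β xs →
    All (λ x → (P x ≡ true → h x ≤ α) × (P x ≡ false → h x ≤ β)) xs →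
    sumᴸ h xs ≤ countᴸ P xs * α + length xs * β
  sumᴸ-split P h α β [] [] = z≤n
  sumᴸ-split P h α β (x ∷ xs) ((≤α , ≤β) ∷ bounds) with P x
  ... | true = begin
    h x + sumᴸ h xs                                   ≤⟨ +-mono-≤ (≤α refl) (sumᴸ-split P h α β xs bounds) ⟩
    α + (countᴸ P xs * α + length xs * β)             ≡⟨ rearrange α (countᴸ P xs * α) (length xs * β) ⟩
    (α + countᴸ P xs * α) + length xs * β             ≤⟨ +-monoʳ-≤ (α + _) (m≤n+m _ β) ⟩
    (α + countᴸ P xs * α) + (β + length xs * β)       ∎
    where
    open ≤-Reasoning
    rearrange : ∀ a c l → a + (c + l) ≡ (a + c) + l
    rearrange = solve-∀
  ... | false = begin
    h x + sumᴸ h xs                                   ≤⟨ +-mono-≤ (≤β refl) (sumᴸ-split P h α β xs bounds) ⟩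
    β + (countᴸ P xs * α + length xs * β)             ≡⟨ rearrange β (countᴸ P xs * α) (length xs * β) ⟩
    countᴸ P xs * α + (β + length xs * β)             ∎
    where
    open ≤-Reasoning
    rearrange : ∀ b c l → b + (c + l) ≡ c + (b + l)
    rearrange = solve-∀

  enumerate : ∀ {n} → (Fin n → Bool) → List (Fin n)
  enumerate {zero} f = []
  enumerate {suc n} f = if f zero then zero ∷ rest else rest
    where
    rest : List (Fin (suc n))
    rest = map suc (enumerate (f ∘ suc))

  enumerate-sound : ∀ {n} (f : Fin n → Bool) → All (λ z → f z ≡ true) (enumerate f)
  enumerate-sound {zero} f = []
  enumerate-sound {suc n} f with f zero in fz
  ... | true = fz ∷ map⁺ (enumerate-sound (f ∘ suc))
  ... | false = map⁺ (enumerate-sound (f ∘ suc))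

  countᴸ-enumerate : ∀ {n} (f P : Fin n → Bool) → countᴸ P (enumerate f) ≡ count (λ x → f x ∧ P x)
  countᴸ-enumerate {zero} f P = refl
  countᴸ-enumerate {suc n} f P with f zero
  ... | true = cong (𝟙 (P zero) +_) (trans (countᴸ-map P suc (enumerate (f ∘ suc))) (countᴸ-enumerate (f ∘ suc) (P ∘ suc)))
  ... | false = trans (countᴸ-map P suc (enumerate (f ∘ suc))) (countᴸ-enumerate (f ∘ suc) (P ∘ suc))

  length-enumerate : ∀ {n} (f : Fin n → Bool) → length (enumerate f) ≡ count f
  length-enumerate f = begin
    length (enumerate f)                ≡⟨ sym (countᴸ-true (enumerate f)) ⟩
    countᴸ (λ _ → true) (enumerate f)   ≡⟨ countᴸ-enumerate f _ ⟩
    count (λ x → f x ∧ true)            ≡⟨ count-cong (∧-identityʳ ∘ f) ⟩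
    count f                             ∎
    where open ≡-Reasoning

module Encoding where
  open import Defs hiding (sym)
  open FinCounting
  open import Data.Bool using (Bool; true; false; _∧_; _∨_; not)
  open import Data.Bool.Properties using (∧-identityʳ; ∧-zeroʳ)
  open import Data.Fin using (Fin; zero; suc)
  open import Data.Fin.Properties using (all?)
  open import Data.Fin.Subset using (Subset; inside; outside; ∣_∣; _─_)
  open import Data.Fin.Subset.Properties using (_⊆?_)
  open import Data.List using (foldr; map; allFin)
  import Data.List as List
  open import Data.List.Properties using (map-tabulate)
  open import Data.Nat using (ℕ; zero; suc; _+_; _≤_; _⊔_; z≤n)
  open import Data.Nat.Properties using (≤-trans; m≤m⊔n; m≤n⊔m; ⊔-lub)
  open import Data.Vec using ([]; _∷_; lookup; tabulate)
  open import Data.Vec.Properties using (lookup∘tabulate; tabulate-cong; []=⇒lookup; lookup⇒[]=)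
  open import Function using (_∘_; id)
  open import Relation.Binary.PropositionalEquality
  open import Relation.Nullary using (Dec; yes; does)

  ∣p∣≡count : ∀ {n} (p : Subset n) → ∣ p ∣ ≡ count (lookup p)
  ∣p∣≡count [] = refl
  ∣p∣≡count (inside ∷ p) = cong suc (∣p∣≡count p)
  ∣p∣≡count (outside ∷ p) = ∣p∣≡count p

  ∣tabulate∣≡count : ∀ {n} (f : Fin n → Bool) → ∣ tabulate f ∣ ≡ count f
  ∣tabulate∣≡count f = trans (∣p∣≡count (tabulate f)) (count-cong (lookup∘tabulate f))

  degOf≡count : ∀ {n} (a : Fin n → Fin n → Bool) v → degOf a v ≡ count (a v)
  degOf≡count a v = trans degOf≡ (∣tabulate∣≡count (a v))
    where
    side≡ : ∀ u → _
    degOf≡ : degOf a v ≡ ∣ tabulate (a v) ∣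
    degOf≡ = cong ∣_∣ (tabulate-cong side≡)
    side≡ u with a v u
    ... | true = refl
    ... | false = refl

  foldr-allFin : ∀ {A : Set} {n} (_∙_ : A → A → A) ε (f : Fin n → A) →
    foldr _∙_ ε (map f (allFin n)) ≡ foldr _∙_ ε (List.tabulate f)
  foldr-allFin _∙_ ε f = cong (foldr _∙_ ε) (map-tabulate id f)

  private
    maxᶠ : ∀ {n} → (Fin n → ℕ) → ℕ
    maxᶠ {zero} f = 0
    maxᶠ {suc n} f = f zero ⊔ maxᶠ (f ∘ suc)

    maxF≡maxᶠ : ∀ {n} (f : Fin n → ℕ) → maxF f ≡ maxᶠ f
    maxF≡maxᶠ f = trans (foldr-allFin _⊔_ 0 f) (go f)
      where
      go : ∀ {n} (f : Fin n → ℕ) → foldr _⊔_ 0 (List.tabulate f) ≡ maxᶠ f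
      go {zero} f = refl
      go {suc n} f = cong (f zero ⊔_) (go (f ∘ suc))

    maxᶠ-ub : ∀ {n} (f : Fin n → ℕ) v → f v ≤ maxᶠ f
    maxᶠ-ub {suc n} f zero = m≤m⊔n (f zero) _
    maxᶠ-ub {suc n} f (suc v) = ≤-trans (maxᶠ-ub (f ∘ suc) v) (m≤n⊔m (f zero) _)

    maxᶠ-lub : ∀ {n} (f : Fin n → ℕ) {B} → (∀ v → f v ≤ B) → maxᶠ f ≤ B
    maxᶠ-lub {zero} f _ = z≤n
    maxᶠ-lub {suc n} f ≤B = ⊔-lub (≤B zero) (maxᶠ-lub (f ∘ suc) (≤B ∘ suc))

  maxF-ub : ∀ {n} (f : Fin n → ℕ) v → f v ≤ maxF f
  maxF-ub f v = subst (f v ≤_) (sym (maxF≡maxᶠ f)) (maxᶠ-ub f v)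

  maxF-lub : ∀ {n} (f : Fin n → ℕ) {B} → (∀ v → f v ≤ B) → maxF f ≤ B
  maxF-lub f ≤B = subst (_≤ _) (sym (maxF≡maxᶠ f)) (maxᶠ-lub f ≤B)

  unionAdj≡anyᶠ : ∀ {m n} (F : Family m n) x y → unionAdj F x y ≡ anyᶠ (λ i → adjT (F i) x y)
  unionAdj≡anyᶠ F x y = trans (foldr-allFin _∨_ false (λ i → adjT (F i) x y)) (go (λ i → adjT (F i) x y))
    where
    go : ∀ {m} (f : Fin m → Bool) → foldr _∨_ false (List.tabulate f) ≡ anyᶠ f
    go {zero} f = refl
    go {suc m} f = cong (f zero ∨_) (go (f ∘ suc))

  totalSize≡∑ : ∀ {m n} (S : Fin m → Subset n) → totalSize S ≡ ∑ (λ i → count (lookup (S i)))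
  totalSize≡∑ S = trans (foldr-allFin _+_ 0 (∣_∣ ∘ S)) (trans (go (∣_∣ ∘ S)) (∑-cong (∣p∣≡count ∘ S)))
    where
    go : ∀ {m} (f : Fin m → ℕ) → foldr _+_ 0 (List.tabulate f) ≡ ∑ f
    go {zero} f = refl
    go {suc m} f = cong (f zero +_) (go (f ∘ suc))

  lookup-─ : ∀ {n} (p q : Subset n) x → lookup (p ─ q) x ≡ lookup p x ∧ not (lookup q x)
  lookup-─ (a ∷ p) (inside ∷ q) zero = sym (∧-zeroʳ a)
  lookup-─ (a ∷ p) (outside ∷ q) zero = sym (∧-identityʳ a)
  lookup-─ (a ∷ p) (_ ∷ q) (suc x) = lookup-─ p q x

  private
    does-true : ∀ {P : Set} (d : Dec P) → does d ≡ true → P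
    does-true (yes p) _ = p

  Event-true : ∀ {q n} (H : Hypergraph q n) S F → Event H S F ≡ true →
    ∀ i x → lookup (S i) x ≡ true → lookup (verts (F i)) x ∧ not (lookup (edge H i) x) ≡ true
  Event-true H S F ev i x x∈S = trans (sym (lookup-─ (verts (F i)) (edge H i) x))
    ([]=⇒lookup (does-true (all? (λ i → S i ⊆? (verts (F i) ─ edge H i))) ev i (lookup⇒[]= x (S i) x∈S)))

module RationalFacts where
  open import Defs hiding (sym)
  open ListCounting using (countᴸ)
  open import Data.Bool using (Bool; true; false; if_then_else_)
  open import Data.Integer as ℤ using (+_)
  import Data.Integer.Properties as ℤ
  open import Data.List using (List; []; _∷_; map; foldr; length)
  import Data.List.Relation.Unary.All as All
  open import Data.List.Relation.Unary.All.Properties using (map⁺)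
  open import Data.Nat as ℕ using (ℕ; suc)
  import Data.Nat.Coprimality as Coprime
  open import Data.Product using (_×_; _,_)
  open import Data.Rational as ℚ using (ℚ; mkℚ; _/_; 0ℚ; 1ℚ; _+_; _-_; _*_; _≤_; _<_)
  open import Data.Rational.Properties
  open import Data.Rational.Solver using (module +-*-Solver)
  import Data.Rational.Unnormalised as ℚᵘ
  import Data.Rational.Unnormalised.Properties as ℚᵘ
  open import Relation.Binary.PropositionalEquality

  open +-*-Solver using (solve; _:+_; _:*_; _:-_; :-_; _:=_; con)

  ⟦⟧≡mkℚ : ∀ k → ⟦ k ⟧ ≡ mkℚ (+ k) 0 (Coprime.sym (Coprime.1-coprimeTo k))
  ⟦⟧≡mkℚ k = normalize-coprime (Coprime.sym (Coprime.1-coprimeTo k))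

  ⟦⟧-+ : ∀ a b → ⟦ a ℕ.+ b ⟧ ≡ ⟦ a ⟧ + ⟦ b ⟧
  ⟦⟧-+ a b rewrite ⟦⟧≡mkℚ a | ⟦⟧≡mkℚ b =
    sym (cong (_/ 1) (trans (cong₂ ℤ._+_ (ℤ.*-identityʳ (+ a)) (ℤ.*-identityʳ (+ b))) (sym (ℤ.pos-+ a b))))

  ⟦⟧-* : ∀ a b → ⟦ a ℕ.* b ⟧ ≡ ⟦ a ⟧ * ⟦ b ⟧
  ⟦⟧-* a b rewrite ⟦⟧≡mkℚ a | ⟦⟧≡mkℚ b = cong (_/ 1) (ℤ.pos-* a b)

  ⟦⟧-mono : ∀ {a b} → a ℕ.≤ b → ⟦ a ⟧ ≤ ⟦ b ⟧
  ⟦⟧-mono {a} {b} a≤b rewrite ⟦⟧≡mkℚ a | ⟦⟧≡mkℚ b =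
    ℚ.*≤* (subst₂ ℤ._≤_ (sym (ℤ.*-identityʳ (+ a))) (sym (ℤ.*-identityʳ (+ b))) (ℤ.+≤+ a≤b))

  ⟦⟧-cancel : ∀ {a b} → ⟦ a ⟧ ≤ ⟦ b ⟧ → a ℕ.≤ b
  ⟦⟧-cancel {a} {b} le rewrite ⟦⟧≡mkℚ a | ⟦⟧≡mkℚ b with le
  ... | ℚ.*≤* a≤b = ℤ.drop‿+≤+ (subst₂ ℤ._≤_ (ℤ.*-identityʳ (+ a)) (ℤ.*-identityʳ (+ b)) a≤b)

  ⟦⟧-pos : ∀ {k} → 1 ℕ.≤ k → 0ℚ < ⟦ k ⟧
  ⟦⟧-pos {suc k} _ rewrite ⟦⟧≡mkℚ (suc k) = ℚ.*<* (ℤ.+<+ (ℕ.s≤s ℕ.z≤n))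

  ⟦⟧-nonNeg : ∀ k → ℚ.NonNegative ⟦ k ⟧
  ⟦⟧-nonNeg k = ℚ.nonNegative (⟦⟧-mono {0} {k} ℕ.z≤n)

  1/_ : (L : ℕ) .{{_ : ℕ.NonZero L}} → ℚ
  1/ L = + 1 / L

  1/-pos : ∀ L .{{_ : ℕ.NonZero L}} → 0ℚ < 1/ L
  1/-pos L = positive⁻¹ _ {{normalize-pos 1 L}}

  ⟦⟧*1/ : ∀ L .{{_ : ℕ.NonZero L}} → ⟦ L ⟧ * 1/ L ≡ 1ℚ
  ⟦⟧*1/ (suc L) = trans (cong₂ _*_ (⟦⟧≡mkℚ (suc L)) (normalize-coprime 1/L-coprime))
    (toℚᵘ-injective (ℚᵘ.≃-trans (toℚᵘ-homo-* (mkℚ (+ suc L) 0 (Coprime.sym (Coprime.1-coprimeTo (suc L))))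
                                              (mkℚ (+ 1) L 1/L-coprime))
                                 (ℚᵘ.*≡* cross)))
    where
    cross : (+ suc L ℤ.* + 1) ℤ.* + 1 ≡ + 1 ℤ.* (+ suc (L ℕ.+ 0))
    cross = trans (ℤ.*-identityʳ _) (trans (ℤ.*-identityʳ _)
              (sym (trans (ℤ.*-identityˡ _) (cong (λ t → + suc t) (ℕ.+-identityʳ L)))))
      where import Data.Nat.Properties as ℕ
    1/L-coprime : Coprime.Coprime 1 (suc L)
    1/L-coprime = Coprime.1-coprimeTo (suc L)

  ≤-cancelˡ-+ : ∀ a b c → a + b ≤ a + c → b ≤ c
  ≤-cancelˡ-+ a b c le = subst₂ _≤_ (-a+[a+x]≡x a b) (-a+[a+x]≡x a c) (+-monoʳ-≤ (ℚ.- a) le)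
    where
    -a+[a+x]≡x : ∀ a x → ℚ.- a + (a + x) ≡ x
    -a+[a+x]≡x = solve 2 (λ a x → :- a :+ (a :+ x) := x) refl

  [1-ε]n≤d⇒N*c≤n : ∀ N .{{_ : ℕ.NonZero N}} ε n d c → ε ≤ 1/ N →
    (1ℚ - ε) * ⟦ n ⟧ ≤ ⟦ d ⟧ → d ℕ.+ c ≡ n → N ℕ.* c ℕ.≤ n
  [1-ε]n≤d⇒N*c≤n N ε n d c ε≤1/N [1-ε]n≤d d+c≡n = ⟦⟧-cancel (begin
    ⟦ N ℕ.* c ⟧           ≡⟨ ⟦⟧-* N c ⟩
    ⟦ N ⟧ * ⟦ c ⟧         ≤⟨ *-monoˡ-≤-nonNeg ⟦ N ⟧ {{⟦⟧-nonNeg N}} c≤n/N ⟩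
    ⟦ N ⟧ * (1/ N * ⟦ n ⟧) ≡⟨ sym (*-assoc ⟦ N ⟧ (1/ N) ⟦ n ⟧) ⟩
    ⟦ N ⟧ * 1/ N * ⟦ n ⟧   ≡⟨ cong (_* ⟦ n ⟧) (⟦⟧*1/ N) ⟩
    1ℚ * ⟦ n ⟧            ≡⟨ *-identityˡ ⟦ n ⟧ ⟩
    ⟦ n ⟧                 ∎)
    where
    open ≤-Reasoning
    split : ∀ e x → (1ℚ - e) * x + e * x ≡ x
    split = solve 2 (λ e x → (con 1ℚ :- e) :* x :+ e :* x := x) refl
    d+c≤d+εn : ⟦ d ⟧ + ⟦ c ⟧ ≤ ⟦ d ⟧ + ε * ⟦ n ⟧
    d+c≤d+εn = subst (_≤ ⟦ d ⟧ + ε * ⟦ n ⟧) (trans (split ε ⟦ n ⟧) (trans (cong ⟦_⟧ (sym d+c≡n)) (⟦⟧-+ d c)))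
                     (+-monoˡ-≤ (ε * ⟦ n ⟧) [1-ε]n≤d)
    c≤n/N : ⟦ c ⟧ ≤ 1/ N * ⟦ n ⟧
    c≤n/N = ≤-trans (≤-cancelˡ-+ ⟦ d ⟧ _ _ d+c≤d+εn) (*-monoʳ-≤-nonNeg ⟦ n ⟧ {{⟦⟧-nonNeg n}} ε≤1/N)

  ⟦c⟧≤C⇒c*Δ≤n : ∀ c Δ n C → ⟦ c ⟧ ≤ C → C * ⟦ Δ ⟧ ≤ ⟦ n ⟧ → c ℕ.* Δ ℕ.≤ n
  ⟦c⟧≤C⇒c*Δ≤n c Δ n C c≤C CΔ≤n =
    ⟦⟧-cancel (subst (_≤ ⟦ n ⟧) (sym (⟦⟧-* c Δ)) (≤-trans (*-monoʳ-≤-nonNeg ⟦ Δ ⟧ {{⟦⟧-nonNeg Δ}} c≤C) CΔ≤n))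

  ⟦c⟧≤C⇒⟦k⟧≤C*⟦Δ⟧ : ∀ k c Δ C → k ℕ.≤ c ℕ.* Δ → ⟦ c ⟧ ≤ C → ⟦ k ⟧ ≤ C * ⟦ Δ ⟧
  ⟦c⟧≤C⇒⟦k⟧≤C*⟦Δ⟧ k c Δ C k≤cΔ c≤C =
    ≤-trans (⟦⟧-mono k≤cΔ) (subst (_≤ C * ⟦ Δ ⟧) (sym (⟦⟧-* c Δ)) (*-monoʳ-≤-nonNeg ⟦ Δ ⟧ {{⟦⟧-nonNeg Δ}} c≤C))

  g*N≤K*L⇒⟦g⟧/L*⟦N⟧≤⟦K⟧ : ∀ g N K L .{{_ : ℕ.NonZero L}} → g ℕ.* N ℕ.≤ K ℕ.* L → ⟦ g ⟧ * 1/ L * ⟦ N ⟧ ≤ ⟦ K ⟧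
  g*N≤K*L⇒⟦g⟧/L*⟦N⟧≤⟦K⟧ g N K L gN≤KL = begin
    ⟦ g ⟧ * 1/ L * ⟦ N ⟧   ≡⟨ swap ⟦ g ⟧ (1/ L) ⟦ N ⟧ ⟩
    ⟦ g ⟧ * ⟦ N ⟧ * 1/ L   ≡⟨ cong (_* 1/ L) (sym (⟦⟧-* g N)) ⟩
    ⟦ g ℕ.* N ⟧ * 1/ L     ≤⟨ *-monoʳ-≤-nonNeg (1/ L) {{ℚ.nonNegative (<⇒≤ (1/-pos L))}} (⟦⟧-mono gN≤KL) ⟩
    ⟦ K ℕ.* L ⟧ * 1/ L     ≡⟨ cong (_* 1/ L) (⟦⟧-* K L) ⟩
    ⟦ K ⟧ * ⟦ L ⟧ * 1/ L   ≡⟨ *-assoc ⟦ K ⟧ ⟦ L ⟧ (1/ L) ⟩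
    ⟦ K ⟧ * (⟦ L ⟧ * 1/ L) ≡⟨ cong (⟦ K ⟧ *_) (⟦⟧*1/ L) ⟩
    ⟦ K ⟧ * 1ℚ            ≡⟨ *-identityʳ ⟦ K ⟧ ⟩
    ⟦ K ⟧                 ∎
    where
    open ≤-Reasoning
    swap : ∀ a b c → a * b * c ≡ a * c * b
    swap = solve 3 (λ a b c → a :* b :* c := a :* c :* b) refl

  module _ {X : Set} (xs : List X) .{{_ : ℕ.NonZero (length xs)}} where

    private
      w : ℚ
      w = 1/ length xs

      weigh : X → ℚ × X
      weigh x = w , x

      w+⟦k⟧*w : ∀ k → w + ⟦ k ⟧ * w ≡ ⟦ suc k ⟧ * w
      w+⟦k⟧*w k = trans (cong (_+ ⟦ k ⟧ * w) (sym (*-identityˡ w)))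
                    (trans (sym (*-distribʳ-+ w 1ℚ ⟦ k ⟧)) (cong (_* w) (sym (⟦⟧-+ 1 k))))

      -- Dist.total and Pr fold anonymous pattern lambdas; the folds are therefore stated for
      -- any step function G that computes like them.
      fold-weights : ∀ (G : ℚ × X → ℚ → ℚ) → (∀ x s → G (w , x) s ≡ w + s) →
        ∀ ys → foldr G 0ℚ (map weigh ys) ≡ ⟦ length ys ⟧ * w
      fold-weights G G≡ [] = sym (*-zeroˡ w)
      fold-weights G G≡ (y ∷ ys) = trans (G≡ y _) (trans (cong (λ t → w + t) (fold-weights G G≡ ys)) (w+⟦k⟧*w (length ys)))

      fold-event : ∀ (ev : X → Bool) (G : ℚ × X → ℚ → ℚ) → (∀ x s → G (w , x) s ≡ (if ev x then w + s else s)) →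
        ∀ ys → foldr G 0ℚ (map weigh ys) ≡ ⟦ countᴸ ev ys ⟧ * w
      fold-event ev G G≡ [] = sym (*-zeroˡ w)
      fold-event ev G G≡ (y ∷ ys) with ev y in evy
      ... | true = trans (G≡ y _) (trans (cong (λ b → if b then w + _ else _) evy)
                     (trans (cong (λ t → w + t) (fold-event ev G G≡ ys)) (w+⟦k⟧*w (countᴸ ev ys))))
      ... | false = trans (G≡ y _) (trans (cong (λ b → if b then w + _ else _) evy) (fold-event ev G G≡ ys))

    uniformDist : Dist X
    uniformDist = record
      { support = map weigh xs
      ; nonneg = map⁺ (All.universal (λ _ → <⇒≤ (1/-pos (length xs))) xs)
      ; total = trans (fold-weights _ (λ _ _ → refl) xs) (⟦⟧*1/ (length xs))
      }

    Pr-uniformDist : ∀ ev → Pr uniformDist ev ≡ ⟦ countᴸ ev xs ⟧ * 1/ length xs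
    Pr-uniformDist ev = fold-event ev _ (λ _ _ → refl) xs

module NatFacts where
  open import Data.Nat
  open import Data.Nat.Properties
  open import Data.Nat.Tactic.RingSolver using (solve-∀)
  open import Data.Product using (Σ; _×_; _,_)
  open import Relation.Binary.PropositionalEquality
  open import Relation.Nullary using (yes; no; contradiction)

  ⌈n/3⌉ : ∀ n → Σ ℕ λ A → n ≤ 3 * A × 3 * A ≤ n + 2
  ⌈n/3⌉ zero = 0 , z≤n , z≤n
  ⌈n/3⌉ (suc n) with ⌈n/3⌉ n
  ... | A , n≤3A , 3A≤n+2 with suc n ≤? 3 * A
  ...   | yes 1+n≤3A = A , 1+n≤3A , m≤n⇒m≤1+n 3A≤n+2
  ...   | no 1+n≰3A = suc A , ≤-trans (s≤s n≤3A) (≤-trans (m≤m+n _ 2) (≤-reflexive (3[1+A] A)))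
                             , ≤-trans (≤-reflexive (sym (3[1+A] A))) (+-monoˡ-≤ 2 (≰⇒> 1+n≰3A))
    where
    3[1+A] : ∀ A → suc (3 * A) + 2 ≡ 3 * suc A
    3[1+A] = solve-∀

  ≥7/10-of-n⇒≥A : ∀ a c n A → c + a ≡ n → 10 * c ≤ 3 * n → 3 * A ≤ n + 2 → A ≤ a
  ≥7/10-of-n⇒≥A a c n A c+a≡n 10c≤3n 3A≤n+2 with A ≤? a
  ... | yes A≤a = A≤a
  ... | no A≰a = contradiction (+-cancelˡ-≤ (21 * n) 10 0 21n+10≤21n) λ ()
    where
    3a+1≤n : 3 * a + 1 ≤ n
    3a+1≤n = +-cancelʳ-≤ 2 _ _ (begin
      3 * a + 1 + 2 ≡⟨ 3a+1+2≡3[1+a] a ⟩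
      3 * suc a     ≤⟨ *-monoʳ-≤ 3 (≰⇒> A≰a) ⟩
      3 * A         ≤⟨ 3A≤n+2 ⟩
      n + 2         ∎)
      where
      open ≤-Reasoning
      3a+1+2≡3[1+a] : ∀ a → 3 * a + 1 + 2 ≡ 3 * suc a
      3a+1+2≡3[1+a] = solve-∀
    7n≤10a : 7 * n ≤ 10 * a
    7n≤10a = +-cancelʳ-≤ (3 * n) _ _ (begin
      7 * n + 3 * n   ≡⟨ sym (*-distribʳ-+ n 7 3) ⟩
      10 * n          ≡⟨ cong (10 *_) (sym c+a≡n) ⟩
      10 * (c + a)    ≡⟨ *-distribˡ-+ 10 c a ⟩
      10 * c + 10 * a ≤⟨ +-monoˡ-≤ (10 * a) 10c≤3n ⟩
      3 * n + 10 * a  ≡⟨ +-comm (3 * n) _ ⟩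
      10 * a + 3 * n  ∎)
      where open ≤-Reasoning
    21n+10≤21n : 21 * n + 10 ≤ 21 * n + 0
    21n+10≤21n = begin
      21 * n + 10          ≡⟨ cong (_+ 10) (*-assoc 3 7 n) ⟩
      3 * (7 * n) + 10     ≤⟨ +-monoˡ-≤ 10 (*-monoʳ-≤ 3 7n≤10a) ⟩
      3 * (10 * a) + 10    ≡⟨ 3[10a]+10≡10[3a+1] a ⟩
      10 * (3 * a + 1)     ≤⟨ *-monoʳ-≤ 10 3a+1≤n ⟩
      10 * n               ≤⟨ *-monoˡ-≤ n {10} {21} (s≤s (s≤s (s≤s (s≤s (s≤s (s≤s (s≤s (s≤s (s≤s (s≤s z≤n)))))))))) ⟩
      21 * n               ≡⟨ sym (+-identityʳ (21 * n)) ⟩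
      21 * n + 0           ∎
      where
      open ≤-Reasoning
      3[10a]+10≡10[3a+1] : ∀ a → 3 * (10 * a) + 10 ≡ 10 * (3 * a + 1)
      3[10a]+10≡10[3a+1] = solve-∀

  ^-distribʳ-* : ∀ a c s → (a * c) ^ s ≡ a ^ s * c ^ s
  ^-distribʳ-* a c zero = refl
  ^-distribʳ-* a c (suc s) = trans (cong ((a * c) *_) (^-distribʳ-* a c s)) (interchange a c (a ^ s) (c ^ s))
    where
    interchange : ∀ a c x y → (a * c) * (x * y) ≡ (a * x) * (c * y)
    interchange = solve-∀

  [1+d]k^d+k^[1+d]≤[1+k]^[1+d] : ∀ k d → suc d * k ^ d + k ^ suc d ≤ suc k ^ suc d
  [1+d]k^d+k^[1+d]≤[1+k]^[1+d] k zero = ≤-reflexive (base k)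
    where
    base : ∀ k → 1 * 1 + k * 1 ≡ suc k * 1
    base = solve-∀
  [1+d]k^d+k^[1+d]≤[1+k]^[1+d] k (suc d) = begin
    suc (suc d) * (k * k ^ d) + k * (k * k ^ d)                   ≤⟨ m≤m+n _ _ ⟩
    (suc (suc d) * (k * k ^ d) + k * (k * k ^ d)) + suc d * k ^ d ≡⟨ factor k d (k ^ d) ⟩
    suc k * (suc d * k ^ d + k * k ^ d)                           ≤⟨ *-monoʳ-≤ (suc k) ([1+d]k^d+k^[1+d]≤[1+k]^[1+d] k d) ⟩
    suc k * (suc k * suc k ^ d)                                   ∎
    where
    open ≤-Reasoning
    factor : ∀ k d X → (suc (suc d) * (k * X) + k * (k * X)) + suc d * X ≡ suc k * (suc d * X + k * X)
    factor = solve-∀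

  d*k^[d-1]+k^d≤[1+k]^d : ∀ k d → d * k ^ pred d + k ^ d ≤ suc k ^ d
  d*k^[d-1]+k^d≤[1+k]^d k zero = ≤-refl
  d*k^[d-1]+k^d≤[1+k]^d k (suc d) = [1+d]k^d+k^[1+d]≤[1+k]^[1+d] k d

module RandomGreedy where
  open import Defs hiding (sym)
  open FinCounting
  open ListCounting
  open NatFacts
  open Encoding using (∣tabulate∣≡count; ∣p∣≡count)
  open import Data.Bool using (Bool; true; false; _∧_; _∨_; not; T)
  open import Data.Bool.Properties using (∨-conicalˡ; ∨-conicalʳ; ∧-conicalˡ; ∧-conicalʳ; ∨-zeroʳ; ∨-identityʳ; ∧-identityʳ; ∧-comm; ∨-assoc; not-injective)
  open import Data.Empty using (⊥-elim)
  open import Data.Fin using (Fin; zero; suc)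
  open import Data.Fin.Subset using (Subset; ∣_∣)
  import Data.Fin.Subset as Subset
  open import Data.List using (List; []; _∷_; length; map; concatMap; take)
  open import Data.List.Properties using (length-take; length-map)
  open import Data.List.Relation.Unary.All using (All; []; _∷_)
  import Data.List.Relation.Unary.All as All
  open import Data.List.Relation.Unary.All.Properties using (map⁺; concat⁺; take⁺)
  open import Data.Nat
  open import Data.Nat.Properties
  open import Data.Nat.Tactic.RingSolver using (solve-∀)
  open import Data.Product using (_×_; _,_; proj₁; proj₂)
  open import Data.Sum using (_⊎_; inj₁; inj₂)
  open import Data.Unit using (⊤; tt)
  open import Data.Vec using (lookup; tabulate)
  open import Data.Vec.Functional using () renaming (_∷_ to _∷ᶠ_)
  open import Data.Vec.Properties using (lookup∘tabulate; []=⇒lookup; lookup⇒[]=)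
  open import Function using (_∘_; mk⇔)
  open import Relation.Binary.PropositionalEquality
  open import Relation.Nullary using (¬_)

  private
    true≢false : ∀ {a : Bool} {X : Set} → a ≡ true → a ≡ false → X
    true≢false refl ()

    ∨-introʳ : ∀ a {b} → b ≡ true → a ∨ b ≡ true
    ∨-introʳ a b≡true = trans (cong (a ∨_) b≡true) (∨-zeroʳ a)

    ∨-elim : ∀ a {b} → a ∨ b ≡ true → a ≡ true ⊎ b ≡ true
    ∨-elim true _ = inj₁ refl
    ∨-elim false b≡true = inj₂ b≡true

    not-true : ∀ {a} → not a ≡ true → a ≡ false
    not-true = not-injective

    true⊎false : ∀ a → a ≡ true ⊎ a ≡ false
    true⊎false true = inj₁ refl
    true⊎false false = inj₂ refl

    ≤ᵇ≡false⇒> : ∀ m n → (m ≤ᵇ n) ≡ false → n < m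
    ≤ᵇ≡false⇒> m n m≰ᵇn = ≰⇒> (λ m≤n → true≢false (T⇒≡true (≤⇒≤ᵇ m≤n)) m≰ᵇn)
      where
      T⇒≡true : ∀ {a} → T a → a ≡ true
      T⇒≡true {true} _ = refl

  -- U is the graph of edges used by the cliques built so far, R the root (an edge of H) of the clique
  -- under construction and Z its new vertices chosen so far, most recent first.
  module Process {n : ℕ} (G : Graph n) (q b Δ A : ℕ) where

    Q K D M : ℕ
    Q = q + b
    K = 10 * (Q * Q)
    D = K * Δ
    M = (2 * Q + K) * Δ

    Adj : Set
    Adj = Fin n → Fin n → Bool

    _∈ᵇ_ : Fin n → List (Fin n) → Bool
    x ∈ᵇ [] = false
    x ∈ᵇ (z ∷ Z) = (x ≟ᵇ z) ∨ (x ∈ᵇ Z)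

    span : (Fin n → Bool) → List (Fin n) → Fin n → Bool
    span R Z x = R x ∨ (x ∈ᵇ Z)

    conflict : Adj → (Fin n → Bool) → List (Fin n) → Fin n → Fin n → Bool
    conflict U R Z x z = span R Z x ∧ (not (adj G x z) ∨ U x z)

    saturated : Adj → Fin n → Bool
    saturated U z = D ≤ᵇ count (U z)

    blocked : Adj → (Fin n → Bool) → List (Fin n) → Fin n → Bool
    blocked U R Z z = anyᶠ (λ x → conflict U R Z x z) ∨ saturated U z

    allowed : Adj → (Fin n → Bool) → List (Fin n) → List (Fin n)
    allowed U R Z = enumerate (not ∘ blocked U R Z)

    -- Keeping exactly the first A allowed vertices (there are always at least A, see A≤allowed) makes
    -- every step branch A ways, so all outcomes of the process are equally likely.
    choices : Adj → (Fin n → Bool) → List (Fin n) → List (Fin n)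
    choices U R Z = take A (allowed U R Z)

    extensions : Adj → (Fin n → Bool) → ℕ → List (Fin n) → List (List (Fin n))
    extensions U R zero Z = Z ∷ []
    extensions U R (suc k) Z = concatMap (λ z → extensions U R k (z ∷ Z)) (choices U R Z)

    Admissible : Adj → (Fin n → Bool) → List (Fin n) → Set
    Admissible U R [] = ⊤
    Admissible U R (z ∷ Z) = Admissible U R Z × blocked U R Z z ≡ false

    partialKAdj : (Fin n → Bool) → List (Fin n) → Adj
    partialKAdj R Z x y = span R Z x ∧ (span R Z y ∧ (not (x ≟ᵇ y) ∧ not (R x ∧ R y)))

    partialK : (Fin n → Bool) → List (Fin n) → SubG n
    partialK R Z = record { verts = tabulate (span R Z) ; adjT = partialKAdj R Z }

    Symmetric : Adj → Set
    Symmetric U = ∀ x y → U x y ≡ U y x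

    unblocked⇒ : ∀ U R Z z → blocked U R Z z ≡ false →
      (∀ x → span R Z x ≡ true → adj G x z ≡ true × U x z ≡ false) × saturated U z ≡ false
    unblocked⇒ U R Z z unblocked = no-conflict , ∨-conicalʳ _ _ unblocked
      where
      no-conflict : ∀ x → span R Z x ≡ true → adj G x z ≡ true × U x z ≡ false
      no-conflict x x∈span = not-injective (∨-conicalˡ _ _ edge-unused) , ∨-conicalʳ _ _ edge-unused
        where
        edge-unused : not (adj G x z) ∨ U x z ≡ false
        edge-unused = subst (λ s → s ∧ (not (adj G x z) ∨ U x z) ≡ false) x∈span
                            (anyᶠ-false _ (∨-conicalˡ _ _ unblocked) x)

    unblocked⇒∉span : ∀ U R Z z → blocked U R Z z ≡ false → span R Z z ≡ false
    unblocked⇒∉span U R Z z unblocked with span R Z z in z∈span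
    ... | false = refl
    ... | true = true≢false (proj₁ (proj₁ (unblocked⇒ U R Z z unblocked) z z∈span)) (irrefl G z)

    ∈ᵇ-∷ : ∀ x z Z → (x ∈ᵇ (z ∷ Z)) ≡ true → x ≡ z ⊎ (x ∈ᵇ Z) ≡ true
    ∈ᵇ-∷ x z Z x∈z∷Z with ∨-elim (x ≟ᵇ z) x∈z∷Z
    ... | inj₁ x≟z = inj₁ (≟ᵇ⇒≡ x≟z)
    ... | inj₂ x∈Z = inj₂ x∈Z

    span-∷ : ∀ R z Z x → span R (z ∷ Z) x ≡ true → x ≡ z ⊎ span R Z x ≡ true
    span-∷ R z Z x x∈span with ∨-elim (R x) x∈span
    ... | inj₁ x∈R = inj₂ (cong (_∨ _) x∈R)
    ... | inj₂ x∈z∷Z with ∈ᵇ-∷ x z Z x∈z∷Z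
    ...   | inj₁ x≡z = inj₁ x≡z
    ...   | inj₂ x∈Z = inj₂ (∨-introʳ (R x) x∈Z)

    admissible⇒∉R : ∀ U R Z → Admissible U R Z → ∀ x → (x ∈ᵇ Z) ≡ true → R x ≡ false
    admissible⇒∉R U R (z ∷ Z) (adm , unblocked) x x∈z∷Z with ∈ᵇ-∷ x z Z x∈z∷Z
    ... | inj₁ refl = ∨-conicalˡ _ _ (unblocked⇒∉span U R Z x unblocked)
    ... | inj₂ x∈Z = admissible⇒∉R U R Z adm x x∈Z

    admissible⇒unsaturated : ∀ U R Z → Admissible U R Z → ∀ x → (x ∈ᵇ Z) ≡ true → saturated U x ≡ false
    admissible⇒unsaturated U R (z ∷ Z) (adm , unblocked) x x∈z∷Z with ∈ᵇ-∷ x z Z x∈z∷Z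
    ... | inj₁ refl = proj₂ (unblocked⇒ U R Z x unblocked)
    ... | inj₂ x∈Z = admissible⇒unsaturated U R Z adm x x∈Z

    count-∈ᵇ : ∀ U R Z → Admissible U R Z → count (_∈ᵇ Z) ≡ length Z
    count-∈ᵇ U R [] _ = count-false n
    count-∈ᵇ U R (z ∷ Z) (adm , unblocked) =
      trans (count-∨-disjoint (_≟ᵇ z) (_∈ᵇ Z) disjoint) (cong₂ _+_ (count-singleton z) (count-∈ᵇ U R Z adm))
      where
      disjoint : ∀ x → (x ≟ᵇ z) ∧ (x ∈ᵇ Z) ≡ false
      disjoint x with x ≟ᵇ z in x≟z
      ... | false = refl
      ... | true = subst (λ w → (w ∈ᵇ Z) ≡ false) (sym (≟ᵇ⇒≡ x≟z)) (∨-conicalʳ _ _ (unblocked⇒∉span U R Z z unblocked))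

    count-span : ∀ U R Z → Admissible U R Z → count (span R Z) ≡ count R + length Z
    count-span U R Z adm = trans (count-∨-disjoint R (_∈ᵇ Z) disjoint) (cong (count R +_) (count-∈ᵇ U R Z adm))
      where
      disjoint : ∀ x → R x ∧ (x ∈ᵇ Z) ≡ false
      disjoint x with x ∈ᵇ Z in x∈Z
      ... | true rewrite admissible⇒∉R U R Z adm x x∈Z = refl
      ... | false with R x
      ...   | true = refl
      ...   | false = refl

    admissible-edge : ∀ U R Z → Symmetric U → Admissible U R Z → ∀ x y →
      span R Z x ≡ true → span R Z y ≡ true → (x ≟ᵇ y) ≡ false → R x ∧ R y ≡ false →
      adj G x y ≡ true × U x y ≡ false
    admissible-edge U R [] U-sym _ x y x∈R y∈R _ not-both =
      true≢false (cong₂ _∧_ (trans (sym (∨-identityʳ (R x))) x∈R) (trans (sym (∨-identityʳ (R y))) y∈R)) not-both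
    admissible-edge U R (z ∷ Z) U-sym (adm , unblocked) x y x∈span y∈span x≢y not-both
      with span-∷ R z Z x x∈span | span-∷ R z Z y y∈span
    ... | inj₁ refl | inj₁ refl = true≢false (≟ᵇ-refl x) x≢y
    ... | inj₁ refl | inj₂ y∈old = let adjacent , unused = proj₁ (unblocked⇒ U R Z x unblocked) y y∈old in
                                   trans (Graph.sym G x y) adjacent , trans (U-sym x y) unused
    ... | inj₂ x∈old | inj₁ refl = proj₁ (unblocked⇒ U R Z y unblocked) x x∈old
    ... | inj₂ x∈old | inj₂ y∈old = admissible-edge U R Z U-sym adm x y x∈old y∈old x≢y not-both

    lookup-verts : ∀ R Z x → lookup (verts (partialK R Z)) x ≡ span R Z x
    lookup-verts R Z x = lookup∘tabulate (span R Z) x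

    partialK-isPartialK : ∀ U (R : Subset n) Z → Admissible U (lookup R) Z → ∣ R ∣ ≡ q → length Z ≡ b →
      IsPartialK (q + b) R (partialK (lookup R) Z)
    partialK-isPartialK U R Z adm ∣R∣≡q ∣Z∣≡b =
      (λ {x} x∈R → lookup⇒[]= x _ (trans (lookup-verts r Z x) (cong (_∨ _) ([]=⇒lookup x∈R)))) ,
      trans (∣tabulate∣≡count (span r Z)) (trans (count-span U r Z adm) (cong₂ _+_ (trans (sym (∣p∣≡count R)) ∣R∣≡q) ∣Z∣≡b)) ,
      λ x y → mk⇔ (edge⇒ x y) (⇒edge x y)
      where
      r : Fin n → Bool
      r = lookup R
      clique : SubG n
      clique = partialK r Z
      edge⇒ : ∀ x y → partialKAdj r Z x y ≡ true →
        x Subset.∈ verts clique × y Subset.∈ verts clique × ¬ x ≡ y × ¬ (x Subset.∈ R × y Subset.∈ R)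
      edge⇒ x y xy with span r Z x in x∈T | span r Z y in y∈T | x ≟ᵇ y in x≟y | r x ∧ r y in both
      ... | true | true | false | false =
        lookup⇒[]= x _ (trans (lookup-verts r Z x) x∈T) , lookup⇒[]= y _ (trans (lookup-verts r Z y) y∈T) ,
        (λ { refl → true≢false (≟ᵇ-refl x) x≟y }) ,
        λ (x∈R , y∈R) → true≢false (cong₂ _∧_ ([]=⇒lookup x∈R) ([]=⇒lookup y∈R)) both
      ⇒edge : ∀ x y → x Subset.∈ verts clique × y Subset.∈ verts clique × ¬ x ≡ y × ¬ (x Subset.∈ R × y Subset.∈ R) →
        partialKAdj r Z x y ≡ true
      ⇒edge x y (x∈T , y∈T , x≢y , ¬both) =
        cong₂ _∧_ (trans (sym (lookup-verts r Z x)) ([]=⇒lookup x∈T))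
         (cong₂ _∧_ (trans (sym (lookup-verts r Z y)) ([]=⇒lookup y∈T))
          (cong₂ _∧_ (cong not (≢⇒≟ᵇ x≢y)) (cong not not-both)))
        where
        not-both : r x ∧ r y ≡ false
        not-both with r x in x∈R | r y in y∈R
        ... | true | true = ⊥-elim (¬both (lookup⇒[]= x R x∈R , lookup⇒[]= y R y∈R))
        ... | true | false = refl
        ... | false | _ = refl

    partialK-edge : ∀ U R Z → Symmetric U → Admissible U R Z → ∀ x y → partialKAdj R Z x y ≡ true →
      adj G x y ≡ true × U x y ≡ false
    partialK-edge U R Z U-sym adm x y xy with span R Z x in x∈T | span R Z y in y∈T | x ≟ᵇ y in x≟y | R x ∧ R y in both
    ... | true | true | false | false = admissible-edge U R Z U-sym adm x y x∈T y∈T x≟y both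

    partialKAdj-sym : ∀ R Z → Symmetric (partialKAdj R Z)
    partialKAdj-sym R Z x y rewrite ≟ᵇ-sym x y | ∧-comm (R x) (R y) = swap (span R Z x) (span R Z y) _
      where
      swap : ∀ a c X → a ∧ (c ∧ X) ≡ c ∧ (a ∧ X)
      swap true c X = refl
      swap false true X = refl
      swap false false X = refl

    degree-partialK : ∀ R Z x → count (partialKAdj R Z x) ≤ 𝟙 (span R Z x) * count (span R Z)
    degree-partialK R Z x with span R Z x
    ... | true = ≤-trans (count-mono (λ y → ∧-conicalˡ (span R Z y) _)) (≤-reflexive (sym (+-identityʳ _)))
    ... | false = ≤-reflexive (count-false n)

    choices-∀ : ∀ {P : Fin n → Set} U R Z → (∀ z → blocked U R Z z ≡ false → P z) → All P (choices U R Z)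
    choices-∀ U R Z unblocked⇒P = take⁺ A (All.map (λ {z} allowed-z → unblocked⇒P z (not-true allowed-z)) (enumerate-sound _))

    extensions-∀ : ∀ {P : List (Fin n) → Set} U R k Z →
      (∀ z → blocked U R Z z ≡ false → All P (extensions U R k (z ∷ Z))) → All P (extensions U R (suc k) Z)
    extensions-∀ U R k Z step = concat⁺ (map⁺ (choices-∀ U R Z step))

    extensions-admissible : ∀ U R k Z → Admissible U R Z →
      All (λ Z′ → Admissible U R Z′ × length Z′ ≡ k + length Z) (extensions U R k Z)
    extensions-admissible U R zero Z adm = (adm , refl) ∷ []
    extensions-admissible U R (suc k) Z adm = extensions-∀ U R k Z λ z unblocked →
      All.map (λ (adm′ , len) → adm′ , trans len (+-suc k _)) (extensions-admissible U R k (z ∷ Z) (adm , unblocked))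

    extensions-⊇ : ∀ U R k Z → All (λ Z′ → ∀ x → (x ∈ᵇ Z) ≡ true → (x ∈ᵇ Z′) ≡ true) (extensions U R k Z)
    extensions-⊇ U R zero Z = (λ _ x∈Z → x∈Z) ∷ []
    extensions-⊇ U R (suc k) Z = extensions-∀ U R k Z λ z _ →
      All.map (λ ⊇z∷Z x x∈Z → ⊇z∷Z x (∨-introʳ (x ≟ᵇ z) x∈Z)) (extensions-⊇ U R k (z ∷ Z))

    _∪ᵃ_ : Adj → Adj → Adj
    (U ∪ᵃ V) x y = U x y ∨ V x y

    outcomes : (m : ℕ) → (Fin m → Subset n) → Adj → List (Family m n)
    outcomes zero es U = (λ ()) ∷ []
    outcomes (suc m) es U = concatMap
      (λ Z → map (partialK (lookup (es zero)) Z ∷ᶠ_) (outcomes m (es ∘ suc) (U ∪ᵃ partialKAdj (lookup (es zero)) Z)))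
      (extensions U (lookup (es zero)) b [])

    load : ∀ {m} → (Fin m → Subset n) → Fin n → ℕ
    load es v = count (λ i → lookup (es i) v)

    -- Every vertex keeps Q units of degree budget per remaining edge through it, so that cliques
    -- built later never exceed M; the total budget bounds the number of saturated vertices.
    record Invariant (m : ℕ) (es : Fin m → Subset n) (U : Adj) : Set where
      field
        used-symmetric : Symmetric U
        degree-budget : ∀ v → count (U v) + Q * load es v ≤ M
        total-budget : ∑ (count ∘ U) + Q * Q * ∑ (load es) ≤ Q * Q * (n * Δ)
        load≤Δ : ∀ v → load es v ≤ Δ
        edge-size : ∀ i → count (lookup (es i)) ≡ q
    open Invariant

    invariant-empty : ∀ {m} (es : Fin m → Subset n) → (∀ v → load es v ≤ Δ) → (∀ i → count (lookup (es i)) ≡ q) →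
      Invariant m es (λ _ _ → false)
    invariant-empty es load≤Δ′ edge-size′ = record
      { used-symmetric = λ _ _ → refl
      ; degree-budget = λ v → subst (λ u → u + Q * load es v ≤ M) (sym (count-false n))
          (≤-trans (*-monoʳ-≤ Q (load≤Δ′ v)) (*-monoˡ-≤ Δ (≤-trans (m≤m+n Q (Q + 0)) (m≤m+n _ K))))
      ; total-budget = subst (λ u → u + Q * Q * ∑ (load es) ≤ Q * Q * (n * Δ))
          (sym (trans (∑-cong {n} (λ _ → count-false n)) (trans (∑-const {n} 0) (*-zeroʳ n))))
          (*-monoʳ-≤ (Q * Q) (≤-trans (∑-mono load≤Δ′) (≤-reflexive (∑-const {n} Δ))))
      ; load≤Δ = load≤Δ′
      ; edge-size = edge-size′
      }

    module Analysis (few-non-neighbours : ∀ x → 10 * Q * count (not ∘ adj G x) ≤ n)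
                    (10QM≤n : 10 * Q * M ≤ n) (3A≤n+2 : 3 * A ≤ n + 2) (1≤q : 1 ≤ q) where

      instance
        Q-nonZero : NonZero Q
        Q-nonZero = >-nonZero (≤-trans 1≤q (m≤m+n q b))

      Δ-pos : ∀ {m es U} → Invariant (suc m) es U → 1 ≤ Δ
      Δ-pos {es = es} I =
        let v , v∈e₀ = count>0⇒witness (lookup (es zero)) (subst (1 ≤_) (sym (edge-size I zero)) 1≤q) in
        ≤-trans (subst (λ t → 1 ≤ 𝟙 t + load (es ∘ suc) v) (sym v∈e₀) (s≤s z≤n)) (load≤Δ I v)

      used≤M : ∀ {m es U} → Invariant m es U → ∀ x → count (U x) ≤ M
      used≤M I x = ≤-trans (m≤m+n _ _) (degree-budget I x)

      10Q*conflicts≤2n : ∀ {m es U} R Z → Invariant m es U → ∀ x →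
        10 * Q * count (conflict U R Z x) ≤ 𝟙 (span R Z x) * (2 * n)
      10Q*conflicts≤2n {U = U} R Z I x with span R Z x
      ... | false = ≤-reflexive (trans (cong (10 * Q *_) (count-false n)) (*-zeroʳ (10 * Q)))
      ... | true = begin
        10 * Q * count (λ z → not (adj G x z) ∨ U x z)
          ≤⟨ *-monoʳ-≤ (10 * Q) (count-∨ (not ∘ adj G x) (U x)) ⟩
        10 * Q * (count (not ∘ adj G x) + count (U x))
          ≡⟨ *-distribˡ-+ (10 * Q) _ _ ⟩
        10 * Q * count (not ∘ adj G x) + 10 * Q * count (U x)
          ≤⟨ +-mono-≤ (few-non-neighbours x) (≤-trans (*-monoʳ-≤ (10 * Q) (used≤M I x)) 10QM≤n) ⟩
        n + n
          ≡⟨ n+n≡1*[2*n] n ⟩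
        1 * (2 * n) ∎
        where
        open ≤-Reasoning
        n+n≡1*[2*n] : ∀ n → n + n ≡ 1 * (2 * n)
        n+n≡1*[2*n] = solve-∀

      10*conflicts≤2n : ∀ {m es U} Z → Invariant (suc m) es U → Admissible U (lookup (es zero)) Z → length Z ≤ b →
        10 * ∑ (count ∘ conflict U (lookup (es zero)) Z) ≤ 2 * n
      10*conflicts≤2n {es = es} {U} Z I adm Z≤b = *-cancelˡ-≤ Q (begin
        Q * (10 * ∑ c)                      ≡⟨ reassoc Q (∑ c) ⟩
        10 * Q * ∑ c                        ≡⟨ sym (∑-*ˡ (10 * Q) c) ⟩
        ∑ (λ x → 10 * Q * c x)              ≤⟨ ∑-mono (10Q*conflicts≤2n R Z I) ⟩
        ∑ (λ x → 𝟙 (span R Z x) * (2 * n))  ≡⟨ ∑-𝟙* (span R Z) (2 * n) ⟩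
        count (span R Z) * (2 * n)          ≡⟨ cong (_* (2 * n)) (count-span U R Z adm) ⟩
        (count R + length Z) * (2 * n)      ≤⟨ *-monoˡ-≤ (2 * n) (+-mono-≤ (≤-reflexive (edge-size I zero)) Z≤b) ⟩
        Q * (2 * n)                         ∎)
        where
        open ≤-Reasoning
        R : Fin n → Bool
        R = lookup (es zero)
        c : Fin n → ℕ
        c = count ∘ conflict U R Z
        reassoc : ∀ Q s → Q * (10 * s) ≡ 10 * Q * s
        reassoc = solve-∀

      10*saturated≤n : ∀ {m es U} → Invariant (suc m) es U → 10 * count (saturated U) ≤ n
      10*saturated≤n {U = U} I = *-cancelˡ-≤ (Q * Q * Δ) {{m*n≢0 (Q * Q) Δ {{m*n≢0 Q Q}} {{>-nonZero (Δ-pos I)}}}} (begin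
        Q * Q * Δ * (10 * count (saturated U)) ≡⟨ reassoc Q Δ (count (saturated U)) ⟩
        count (saturated U) * D                ≤⟨ markov D (count ∘ U) ⟩
        ∑ (count ∘ U)                          ≤⟨ ≤-trans (m≤m+n _ _) (total-budget I) ⟩
        Q * Q * (n * Δ)                        ≡⟨ reorder Q Δ n ⟩
        Q * Q * Δ * n                          ∎)
        where
        open ≤-Reasoning
        reassoc : ∀ Q Δ s → Q * Q * Δ * (10 * s) ≡ s * (10 * (Q * Q) * Δ)
        reassoc = solve-∀
        reorder : ∀ Q Δ n → Q * Q * (n * Δ) ≡ Q * Q * Δ * n
        reorder = solve-∀

      10*blocked≤3n : ∀ {m es U} Z → Invariant (suc m) es U → Admissible U (lookup (es zero)) Z → length Z ≤ b →
        10 * count (blocked U (lookup (es zero)) Z) ≤ 3 * n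
      10*blocked≤3n {es = es} {U} Z I adm Z≤b = begin
        10 * count (blocked U R Z)
          ≤⟨ *-monoʳ-≤ 10 (count-∨ (λ z → anyᶠ (λ x → conflict U R Z x z)) (saturated U)) ⟩
        10 * (count (λ z → anyᶠ (λ x → conflict U R Z x z)) + count (saturated U))
          ≤⟨ *-monoʳ-≤ 10 (+-monoˡ-≤ _ (count-anyᶠ≤∑ (conflict U R Z))) ⟩
        10 * (∑ (count ∘ conflict U R Z) + count (saturated U))
          ≡⟨ *-distribˡ-+ 10 (∑ (count ∘ conflict U R Z)) (count (saturated U)) ⟩
        10 * ∑ (count ∘ conflict U R Z) + 10 * count (saturated U)
          ≤⟨ +-mono-≤ (10*conflicts≤2n Z I adm Z≤b) (10*saturated≤n I) ⟩
        2 * n + n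
          ≡⟨ 2n+n≡3n n ⟩
        3 * n ∎
        where
        open ≤-Reasoning
        R : Fin n → Bool
        R = lookup (es zero)
        2n+n≡3n : ∀ n → 2 * n + n ≡ 3 * n
        2n+n≡3n = solve-∀

      A≤allowed : ∀ {m es U} Z → Invariant (suc m) es U → Admissible U (lookup (es zero)) Z → length Z ≤ b →
        A ≤ length (allowed U (lookup (es zero)) Z)
      A≤allowed {es = es} {U} Z I adm Z≤b = subst (A ≤_) (sym (length-enumerate (not ∘ blocked U R Z)))
        (≥7/10-of-n⇒≥A _ _ n A (count-not (blocked U R Z)) (10*blocked≤3n Z I adm Z≤b) 3A≤n+2)
        where
        R : Fin n → Bool
        R = lookup (es zero)

      length-extensions : ∀ {m es U} → Invariant (suc m) es U → ∀ k Z → Admissible U (lookup (es zero)) Z →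
        length Z + k ≤ b → length (extensions U (lookup (es zero)) k Z) ≡ A ^ k
      length-extensions I zero Z adm _ = refl
      length-extensions {es = es} {U} I (suc k) Z adm Z+1+k≤b = begin
        length (concatMap (λ z → extensions U R k (z ∷ Z)) (choices U R Z))
          ≡⟨ length-concatMap _ (choices U R Z) ⟩
        sumᴸ (λ z → length (extensions U R k (z ∷ Z))) (choices U R Z)
          ≡⟨ sumᴸ-const (choices-∀ U R Z λ z unblocked →
               length-extensions I k (z ∷ Z) (adm , unblocked) (subst (_≤ b) (+-suc (length Z) k) Z+1+k≤b)) ⟩
        length (choices U R Z) * A ^ k
          ≡⟨ cong (_* A ^ k) (trans (length-take A _) (m≤n⇒m⊓n≡m (A≤allowed Z I adm (≤-trans (m≤m+n _ _) Z+1+k≤b)))) ⟩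
        A * A ^ k ∎
        where
        open ≡-Reasoning
        R : Fin n → Bool
        R = lookup (es zero)

      module Step {m es U} (I : Invariant (suc m) es U) (Z : List (Fin n))
                  (adm : Admissible U (lookup (es zero)) Z) (∣Z∣≡b : length Z ≡ b) where

        R : Fin n → Bool
        R = lookup (es zero)

        es′ : Fin m → Subset n
        es′ = es ∘ suc

        U′ : Adj
        U′ = U ∪ᵃ partialKAdj R Z

        ∣span∣≡Q : count (span R Z) ≡ Q
        ∣span∣≡Q = trans (count-span U R Z adm) (cong₂ _+_ (edge-size I zero) ∣Z∣≡b)

        degree-U′ : ∀ v → count (U′ v) ≤ count (U v) + 𝟙 (span R Z v) * Q
        degree-U′ v = begin
          count (U′ v)                                   ≤⟨ count-∨ (U v) (partialKAdj R Z v) ⟩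
          count (U v) + count (partialKAdj R Z v)        ≤⟨ +-monoʳ-≤ (count (U v)) (degree-partialK R Z v) ⟩
          count (U v) + 𝟙 (span R Z v) * count (span R Z) ≡⟨ cong (λ c → count (U v) + 𝟙 (span R Z v) * c) ∣span∣≡Q ⟩
          count (U v) + 𝟙 (span R Z v) * Q               ∎
          where open ≤-Reasoning

        budget-root : ∀ v → R v ≡ true → count (U′ v) + Q * load es′ v ≤ M
        budget-root v v∈R = begin
          count (U′ v) + Q * load es′ v                       ≤⟨ +-monoˡ-≤ _ (degree-U′ v) ⟩
          count (U v) + 𝟙 (span R Z v) * Q + Q * load es′ v   ≡⟨ cong (λ s → count (U v) + 𝟙 s * Q + Q * load es′ v) (cong (_∨ _) v∈R) ⟩
          count (U v) + 1 * Q + Q * load es′ v                ≡⟨ factor (count (U v)) Q (load es′ v) ⟩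
          count (U v) + Q * (1 + load es′ v)                  ≡⟨ cong (λ r → count (U v) + Q * (𝟙 r + load es′ v)) (sym v∈R) ⟩
          count (U v) + Q * load es v                         ≤⟨ degree-budget I v ⟩
          M                                                   ∎
          where
          open ≤-Reasoning
          factor : ∀ u Q l → u + 1 * Q + Q * l ≡ u + Q * (1 + l)
          factor = solve-∀

        budget-new : ∀ v → (v ∈ᵇ Z) ≡ true → count (U′ v) + Q * load es′ v ≤ M
        budget-new v v∈Z = begin
          count (U′ v) + Q * load es′ v                       ≤⟨ +-monoˡ-≤ _ (degree-U′ v) ⟩
          count (U v) + 𝟙 (span R Z v) * Q + Q * load es′ v   ≡⟨ cong (λ s → count (U v) + 𝟙 s * Q + Q * load es′ v) (∨-introʳ (R v) v∈Z) ⟩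
          count (U v) + 1 * Q + Q * load es′ v                ≤⟨ +-mono-≤ (+-monoˡ-≤ (1 * Q) (<⇒≤ unsaturated)) (*-monoʳ-≤ Q load′≤Δ) ⟩
          D + 1 * Q + Q * Δ                                   ≤⟨ +-monoˡ-≤ (Q * Δ) (+-monoʳ-≤ D (≤-trans (≤-reflexive (*-identityˡ Q)) (m≤m*n Q Δ {{>-nonZero (Δ-pos I)}}))) ⟩
          D + Q * Δ + Q * Δ                                   ≡⟨ collect Q K Δ ⟩
          M                                                   ∎
          where
          open ≤-Reasoning
          unsaturated : count (U v) < D
          unsaturated = ≤ᵇ≡false⇒> D _ (admissible⇒unsaturated U R Z adm v v∈Z)
          load′≤Δ : load es′ v ≤ Δ
          load′≤Δ = ≤-trans (m≤n+m _ _) (load≤Δ I v)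
          collect : ∀ Q K Δ → K * Δ + Q * Δ + Q * Δ ≡ (2 * Q + K) * Δ
          collect = solve-∀

        budget-outside : ∀ v → span R Z v ≡ false → count (U′ v) + Q * load es′ v ≤ M
        budget-outside v v∉span = begin
          count (U′ v) + Q * load es′ v                       ≤⟨ +-monoˡ-≤ _ (degree-U′ v) ⟩
          count (U v) + 𝟙 (span R Z v) * Q + Q * load es′ v   ≡⟨ cong (λ s → count (U v) + 𝟙 s * Q + Q * load es′ v) v∉span ⟩
          count (U v) + 0 + Q * load es′ v                    ≡⟨ cong (λ u → u + Q * (load es′ v)) (+-identityʳ (count (U v))) ⟩
          count (U v) + Q * (𝟙 false + load es′ v)            ≡⟨ cong (λ r → count (U v) + Q * (𝟙 r + load es′ v)) (sym (∨-conicalˡ _ _ v∉span)) ⟩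
          count (U v) + Q * load es v                         ≤⟨ degree-budget I v ⟩
          M                                                   ∎
          where open ≤-Reasoning

        degree-budget-step : ∀ v → count (U′ v) + Q * load es′ v ≤ M
        degree-budget-step v with true⊎false (R v) | true⊎false (v ∈ᵇ Z)
        ... | inj₁ v∈R | _ = budget-root v v∈R
        ... | inj₂ _ | inj₁ v∈Z = budget-new v v∈Z
        ... | inj₂ v∉R | inj₂ v∉Z = budget-outside v (cong₂ _∨_ v∉R v∉Z)

        ∑load : ∑ (load es) ≡ q + ∑ (load es′)
        ∑load = trans (∑-+ (𝟙 ∘ R) (load es′)) (cong (_+ ∑ (load es′)) (trans (∑-𝟙 R) (edge-size I zero)))

        total-budget-step : ∑ (count ∘ U′) + Q * Q * ∑ (load es′) ≤ Q * Q * (n * Δ)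
        total-budget-step = begin
          ∑ (count ∘ U′) + Q * Q * ∑ (load es′)
            ≤⟨ +-monoˡ-≤ _ (∑-mono degree-U′) ⟩
          ∑ (λ v → count (U v) + 𝟙 (span R Z v) * Q) + Q * Q * ∑ (load es′)
            ≡⟨ cong (_+ Q * Q * ∑ (load es′)) (trans (∑-+ (count ∘ U) _) (cong (∑ (count ∘ U) +_) (∑-𝟙* (span R Z) Q))) ⟩
          ∑ (count ∘ U) + count (span R Z) * Q + Q * Q * ∑ (load es′)
            ≡⟨ cong (λ c → ∑ (count ∘ U) + c * Q + Q * Q * ∑ (load es′)) ∣span∣≡Q ⟩
          ∑ (count ∘ U) + Q * Q + Q * Q * ∑ (load es′)
            ≤⟨ +-monoˡ-≤ _ (+-monoʳ-≤ (∑ (count ∘ U)) (m≤m*n (Q * Q) q {{>-nonZero 1≤q}})) ⟩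
          ∑ (count ∘ U) + Q * Q * q + Q * Q * ∑ (load es′)
            ≡⟨ factor (∑ (count ∘ U)) (Q * Q) q (∑ (load es′)) ⟩
          ∑ (count ∘ U) + Q * Q * (q + ∑ (load es′))
            ≡⟨ cong (λ l → ∑ (count ∘ U) + Q * Q * l) (sym ∑load) ⟩
          ∑ (count ∘ U) + Q * Q * ∑ (load es)
            ≤⟨ total-budget I ⟩
          Q * Q * (n * Δ) ∎
          where
          open ≤-Reasoning
          factor : ∀ s P q r → s + P * q + P * r ≡ s + P * (q + r)
          factor = solve-∀

        invariant : Invariant m es′ U′
        invariant = record
          { used-symmetric = λ x y → cong₂ _∨_ (used-symmetric I x y) (partialKAdj-sym R Z x y)
          ; degree-budget = degree-budget-step
          ; total-budget = total-budget-step
          ; load≤Δ = λ v → ≤-trans (m≤n+m _ _) (load≤Δ I v)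
          ; edge-size = edge-size I ∘ suc
          }

      admissible-b : ∀ U R → All (λ Z → Admissible U R Z × length Z ≡ b) (extensions U R b [])
      admissible-b U R = All.map (λ (adm , len) → adm , trans len (+-identityʳ b)) (extensions-admissible U R b [] tt)

      length-outcomes : ∀ m es U → Invariant m es U → length (outcomes m es U) ≡ (A ^ b) ^ m
      length-outcomes zero es U I = refl
      length-outcomes (suc m) es U I = begin
        length (outcomes (suc m) es U)                ≡⟨ length-concatMap _ (extensions U R b []) ⟩
        sumᴸ (λ Z → length (next Z)) (extensions U R b []) ≡⟨ sumᴸ-const (All.map (λ (adm , len) →
                                                               trans (length-map _ (outcomes m (es ∘ suc) _))
                                                                     (length-outcomes m (es ∘ suc) _ (Step.invariant I _ adm len)))
                                                             (admissible-b U R)) ⟩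
        length (extensions U R b []) * (A ^ b) ^ m    ≡⟨ cong (_* (A ^ b) ^ m) (length-extensions I b [] tt ≤-refl) ⟩
        A ^ b * (A ^ b) ^ m                           ∎
        where
        open ≡-Reasoning
        R : Fin n → Bool
        R = lookup (es zero)
        next : List (Fin n) → List (Family (suc m) n)
        next Z = map (partialK R Z ∷ᶠ_) (outcomes m (es ∘ suc) (U ∪ᵃ partialKAdj R Z))

      record Sound (m : ℕ) (es : Fin m → Subset n) (U : Adj) (F : Family m n) : Set where
        field
          partialK-in-G : ∀ i → IsPartialK (q + b) (es i) (F i) × IsSubgraph (F i) G
          edge-disjoint : ∀ i j → ¬ i ≡ j → ∀ x y → ¬ (adjT (F i) x y ≡ true × adjT (F j) x y ≡ true)
          avoids-used : ∀ i x y → adjT (F i) x y ≡ true → U x y ≡ false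
          degree≤M : ∀ v → count (λ y → U v y ∨ anyᶠ (λ i → adjT (F i) v y)) ≤ M
      open Sound

      sound-cons : ∀ {m es U} (I : Invariant (suc m) es U) Z → Admissible U (lookup (es zero)) Z → length Z ≡ b →
        ∀ {F} → Sound m (es ∘ suc) (U ∪ᵃ partialKAdj (lookup (es zero)) Z) F →
        Sound (suc m) es U (partialK (lookup (es zero)) Z ∷ᶠ F)
      sound-cons {es = es} {U} I Z adm ∣Z∣≡b S = record
        { partialK-in-G = λ { zero → partialK-isPartialK U (es zero) Z adm (trans (∣p∣≡count (es zero)) (edge-size I zero)) ∣Z∣≡b
                                   , λ x y → proj₁ ∘ partialK-edge U R Z (used-symmetric I) adm x y
                            ; (suc i) → partialK-in-G S i }
        ; edge-disjoint = disjoint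
        ; avoids-used = λ { zero x y → proj₂ ∘ partialK-edge U R Z (used-symmetric I) adm x y
                          ; (suc i) x y → ∨-conicalˡ _ _ ∘ avoids-used S i x y }
        ; degree≤M = λ v → subst (_≤ M) (count-cong λ y → ∨-assoc (U v y) _ _) (degree≤M S v)
        }
        where
        R : Fin n → Bool
        R = lookup (es zero)
        disjoint : ∀ i j → ¬ i ≡ j → ∀ x y →
          ¬ (adjT ((partialK R Z ∷ᶠ _) i) x y ≡ true × adjT ((partialK R Z ∷ᶠ _) j) x y ≡ true)
        disjoint zero zero i≢j = ⊥-elim (i≢j refl)
        disjoint zero (suc j) _ x y (xy∈K , xy∈Fj) = true≢false xy∈K (∨-conicalʳ (U x y) _ (avoids-used S j x y xy∈Fj))
        disjoint (suc i) zero _ x y (xy∈Fi , xy∈K) = true≢false xy∈K (∨-conicalʳ (U x y) _ (avoids-used S i x y xy∈Fi))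
        disjoint (suc i) (suc j) i≢j = edge-disjoint S i j (i≢j ∘ cong suc)

      outcomes-sound : ∀ m es U → Invariant m es U → All (Sound m es U) (outcomes m es U)
      outcomes-sound zero es U I = sound-nil ∷ []
        where
        sound-nil : Sound zero es U (λ ())
        sound-nil = record
          { partialK-in-G = λ ()
          ; edge-disjoint = λ ()
          ; avoids-used = λ ()
          ; degree≤M = λ v → subst (_≤ M) (count-cong λ y → sym (∨-identityʳ (U v y))) (used≤M I v)
          }
      outcomes-sound (suc m) es U I = concat⁺ (map⁺ (All.map (λ {Z} (adm , len) →
        map⁺ (All.map (sound-cons I Z adm len) (outcomes-sound m (es ∘ suc) _ (Step.invariant I Z adm len))))
        (admissible-b U (lookup (es zero)))))

    covers : (Fin n → Bool) → List (Fin n) → Bool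
    covers S Z = allᶠ (λ x → not (S x) ∨ (x ∈ᵇ Z))

    Disjoint : (Fin n → Bool) → List (Fin n) → Set
    Disjoint S Z = ∀ x → S x ≡ true → (x ∈ᵇ Z) ≡ false

    disjoint-∷ : ∀ S Z {z} → S z ≡ false → Disjoint S Z → Disjoint S (z ∷ Z)
    disjoint-∷ S Z {z} z∉S S#Z x x∈S with x ≟ᵇ z in x≟z
    ... | true = true≢false (subst (λ w → S w ≡ true) (≟ᵇ⇒≡ x≟z) x∈S) z∉S
    ... | false = S#Z x x∈S

    disjoint-∖ : ∀ S Z z → Disjoint S Z → Disjoint (S ∖ z) (z ∷ Z)
    disjoint-∖ S Z z S#Z x x∈S∖z = cong₂ _∨_ (not-injective (∧-conicalʳ _ _ x∈S∖z)) (S#Z x (∧-conicalˡ _ _ x∈S∖z))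

    covers-∖ : ∀ S {z} Z → (z ∈ᵇ Z) ≡ true → covers S Z ≡ covers (S ∖ z) Z
    covers-∖ S {z} Z z∈Z = allᶠ-cong pointwise
      where
      pointwise : ∀ x → not (S x) ∨ (x ∈ᵇ Z) ≡ not ((S ∖ z) x) ∨ (x ∈ᵇ Z)
      pointwise x with x ≟ᵇ z in x≟z
      ... | false = cong (λ s → not s ∨ (x ∈ᵇ Z)) (sym (∧-identityʳ (S x)))
      ... | true = trans (cong (not (S x) ∨_) x∈Z) (trans (∨-zeroʳ _) (sym (trans (cong (_ ∨_) x∈Z) (∨-zeroʳ _))))
        where
        x∈Z : (x ∈ᵇ Z) ≡ true
        x∈Z = subst (λ w → (w ∈ᵇ Z) ≡ true) (sym (≟ᵇ⇒≡ x≟z)) z∈Z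

    covers-disjoint : ∀ S Z → Disjoint S Z → countᴸ (covers S) (Z ∷ []) * A ^ count S ≤ 0 ^ count S * A ^ 0
    covers-disjoint S Z S#Z with count S in ∣S∣
    ... | zero = *-monoˡ-≤ 1 (subst (_≤ 1) (sym (+-identityʳ _)) (𝟙≤1 (covers S Z)))
    ... | suc d = ≤-reflexive (cong (_* A ^ suc d) (trans (+-identityʳ _) (cong 𝟙 uncovered)))
      where
      uncovered : covers S Z ≡ false
      uncovered with covers S Z in covered
      ... | false = refl
      ... | true = let x , x∈S = count>0⇒witness S (subst (1 ≤_) (sym ∣S∣) (s≤s z≤n)) in
        true≢false (allᶠ-elim _ covered x) (subst (λ s → not s ∨ (x ∈ᵇ Z) ≡ false) (sym x∈S) (S#Z x x∈S))

    -- A covering extension by k+1 vertices either picks a vertex z of S first (at most |S| ways, leaving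
    -- |S|-1 vertices to cover with k picks) or a vertex outside S (at most A ways, leaving |S| to cover).
    extensions-covering : ∀ U R k Z S → Disjoint S Z →
      countᴸ (covers S) (extensions U R k Z) * A ^ count S ≤ k ^ count S * A ^ k
    extensions-covering U R zero Z S S#Z = covers-disjoint S Z S#Z
    extensions-covering U R (suc k) Z S S#Z = begin
      countᴸ (covers S) (concatMap (λ z → extensions U R k (z ∷ Z)) cs) * A ^ d
        ≡⟨ cong (_* A ^ d) (countᴸ-concatMap (covers S) _ cs) ⟩
      sumᴸ h cs * A ^ d
        ≡⟨ sym (sumᴸ-*ʳ h (A ^ d) cs) ⟩
      sumᴸ (λ z → h z * A ^ d) cs
        ≤⟨ sumᴸ-split S (λ z → h z * A ^ d) α β cs (All.universal (λ z → via-S z , outside-S z) cs) ⟩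
      countᴸ S cs * α + length cs * β
        ≤⟨ +-mono-≤ (*-monoˡ-≤ α S∩cs≤d) (*-monoˡ-≤ β (≤-trans (≤-reflexive (length-take A _)) (m⊓n≤m A _))) ⟩
      d * α + A * β
        ≡⟨ factor d A (k ^ pred d) (k ^ d) (A ^ k) ⟩
      (d * k ^ pred d + k ^ d) * (A * A ^ k)
        ≤⟨ *-monoˡ-≤ (A * A ^ k) (d*k^[d-1]+k^d≤[1+k]^d k d) ⟩
      suc k ^ d * (A * A ^ k) ∎
      where
      open ≤-Reasoning
      d : ℕ
      d = count S
      cs : List (Fin n)
      cs = choices U R Z
      h : Fin n → ℕ
      h z = countᴸ (covers S) (extensions U R k (z ∷ Z))
      α : ℕ
      α = A * (k ^ pred d * A ^ k)
      β : ℕ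
      β = k ^ d * A ^ k
      factor : ∀ d A x y Ak → d * (A * (x * Ak)) + A * (y * Ak) ≡ (d * x + y) * (A * Ak)
      factor = solve-∀
      S∩cs≤d : countᴸ S cs ≤ d
      S∩cs≤d = ≤-trans (countᴸ-take S A _)
        (≤-trans (≤-reflexive (countᴸ-enumerate _ S)) (count-mono {g = S} (λ x → ∧-conicalʳ (not (blocked U R Z x)) (S x))))
      outside-S : ∀ z → S z ≡ false → h z * A ^ d ≤ β
      outside-S z z∉S = extensions-covering U R k (z ∷ Z) S (disjoint-∷ S Z z∉S S#Z)
      via-S : ∀ z → S z ≡ true → h z * A ^ d ≤ α
      via-S z z∈S = begin
        h z * A ^ d                                       ≡⟨ cong (λ t → h z * A ^ t) d≡1+d′ ⟩
        h z * (A * A ^ count (S ∖ z))                     ≡⟨ swap (h z) A (A ^ count (S ∖ z)) ⟩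
        A * (h z * A ^ count (S ∖ z))                     ≡⟨ cong (λ t → A * (t * A ^ count (S ∖ z))) h≡ ⟩
        A * (countᴸ (covers (S ∖ z)) exts * A ^ count (S ∖ z))
          ≤⟨ *-monoʳ-≤ A (extensions-covering U R k (z ∷ Z) (S ∖ z) (disjoint-∖ S Z z S#Z)) ⟩
        A * (k ^ count (S ∖ z) * A ^ k)                   ≡⟨ cong (λ t → A * (k ^ t * A ^ k)) (cong pred (sym d≡1+d′)) ⟩
        α                                                 ∎
        where
        exts : List (List (Fin n))
        exts = extensions U R k (z ∷ Z)
        d≡1+d′ : d ≡ suc (count (S ∖ z))
        d≡1+d′ = count-remove S z z∈S
        swap : ∀ a b c → a * (b * c) ≡ b * (a * c)
        swap = solve-∀
        h≡ : h z ≡ countᴸ (covers (S ∖ z)) exts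
        h≡ = countᴸ-cong (All.map (λ {Z′} ⊇ → covers-∖ S Z′ (⊇ z (cong (_∨ (z ∈ᵇ Z)) (≟ᵇ-refl z))))
                                  (extensions-⊇ U R k (z ∷ Z)))

    within : (Fin n → Bool) → (Fin n → Bool) → SubG n → Bool
    within e S T = allᶠ (λ x → not (S x) ∨ (lookup (verts T) x ∧ not (e x)))

    event : ∀ {m} → (Fin m → Subset n) → (Fin m → Subset n) → Family m n → Bool
    event es S F = allᶠ (λ i → within (lookup (es i)) (lookup (S i)) (F i))

    size : ∀ {m} → (Fin m → Subset n) → ℕ
    size S = ∑ (λ i → count (lookup (S i)))

    within-partialK⇒covers : ∀ R S Z → within R S (partialK R Z) ≡ true → covers S Z ≡ true
    within-partialK⇒covers R S Z S⊆T∖R = allᶠ-true _ λ x →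
      new-vertex (S x) (lookup-verts R Z x) (allᶠ-elim _ S⊆T∖R x)
      where
      new-vertex : ∀ {t r z} s → t ≡ r ∨ z → not s ∨ (t ∧ not r) ≡ true → not s ∨ z ≡ true
      new-vertex false _ _ = refl
      new-vertex {true} {false} true t≡z _ = sym t≡z
      new-vertex {true} {true} true _ ()
      new-vertex {false} true _ ()

    outcomes-event : ∀ m es U S → countᴸ (event es S) (outcomes m es U) * A ^ size S ≤ b ^ size S * (A ^ b) ^ m
    outcomes-event zero es U S = ≤-refl
    outcomes-event (suc m) es U S = begin
      countᴸ (event es S) (concatMap next exts) * A ^ (s₀ + s′)
        ≡⟨ cong (_* A ^ (s₀ + s′)) (countᴸ-concatMap _ next exts) ⟩
      sumᴸ h exts * A ^ (s₀ + s′)                    ≡⟨ cong (sumᴸ h exts *_) (^-distribˡ-+-* A s₀ s′) ⟩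
      sumᴸ h exts * (A ^ s₀ * A ^ s′)                ≡⟨ swap (sumᴸ h exts) (A ^ s₀) (A ^ s′) ⟩
      sumᴸ h exts * A ^ s′ * A ^ s₀                  ≡⟨ cong (_* A ^ s₀) (sym (sumᴸ-*ʳ h (A ^ s′) exts)) ⟩
      sumᴸ (λ Z → h Z * A ^ s′) exts * A ^ s₀        ≤⟨ *-monoˡ-≤ (A ^ s₀) (sumᴸ-mono exts per-extension) ⟩
      sumᴸ (λ Z → 𝟙 (covers S₀ Z) * W) exts * A ^ s₀ ≡⟨ cong (_* A ^ s₀) (sumᴸ-𝟙* (covers S₀) W exts) ⟩
      countᴸ (covers S₀) exts * W * A ^ s₀           ≡⟨ swap′ (countᴸ (covers S₀) exts) W (A ^ s₀) ⟩
      countᴸ (covers S₀) exts * A ^ s₀ * W           ≤⟨ *-monoˡ-≤ W (extensions-covering U R b [] S₀ (λ _ _ → refl)) ⟩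
      b ^ s₀ * A ^ b * (b ^ s′ * (A ^ b) ^ m)        ≡⟨ interchange (b ^ s₀) (A ^ b) (b ^ s′) ((A ^ b) ^ m) ⟩
      b ^ s₀ * b ^ s′ * (A ^ b * (A ^ b) ^ m)        ≡⟨ cong (_* (A ^ b * (A ^ b) ^ m)) (sym (^-distribˡ-+-* b s₀ s′)) ⟩
      b ^ (s₀ + s′) * (A ^ b * (A ^ b) ^ m)          ∎
      where
      open ≤-Reasoning
      R : Fin n → Bool
      R = lookup (es zero)
      S₀ : Fin n → Bool
      S₀ = lookup (S zero)
      s₀ : ℕ
      s₀ = count S₀
      s′ : ℕ
      s′ = size (S ∘ suc)
      W : ℕ
      W = b ^ s′ * (A ^ b) ^ m
      exts : List (List (Fin n))
      exts = extensions U R b []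
      rest : List (Fin n) → List (Family m n)
      rest Z = outcomes m (es ∘ suc) (U ∪ᵃ partialKAdj R Z)
      next : List (Fin n) → List (Family (suc m) n)
      next Z = map (partialK R Z ∷ᶠ_) (rest Z)
      h : List (Fin n) → ℕ
      h Z = countᴸ (event es S) (next Z)
      per-extension : ∀ Z → h Z * A ^ s′ ≤ 𝟙 (covers S₀ Z) * W
      per-extension Z = begin
        h Z * A ^ s′
          ≡⟨ cong (_* A ^ s′) (trans (countᴸ-map _ _ (rest Z)) (countᴸ-∧ˡ (within R S₀ (partialK R Z)) _ (rest Z))) ⟩
        𝟙 (within R S₀ (partialK R Z)) * countᴸ (event (es ∘ suc) (S ∘ suc)) (rest Z) * A ^ s′
          ≡⟨ *-assoc (𝟙 (within R S₀ (partialK R Z))) _ _ ⟩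
        𝟙 (within R S₀ (partialK R Z)) * (countᴸ (event (es ∘ suc) (S ∘ suc)) (rest Z) * A ^ s′)
          ≤⟨ *-mono-≤ (𝟙-mono (within-partialK⇒covers R S₀ Z)) (outcomes-event m (es ∘ suc) _ (S ∘ suc)) ⟩
        𝟙 (covers S₀ Z) * W ∎
      swap : ∀ a b c → a * (b * c) ≡ a * c * b
      swap = solve-∀
      swap′ : ∀ a b c → a * b * c ≡ a * c * b
      swap′ = solve-∀
      interchange : ∀ a b c d → a * b * (c * d) ≡ a * c * (b * d)
      interchange = solve-∀

module Construction where
  open import Defs hiding (sym)
  open FinCounting
  open ListCounting
  open Encoding
  open RationalFacts
  open NatFacts
  open RandomGreedy
  open import Data.Bool using (true; false; not; _∧_; _∨_)
  open import Data.Fin using (Fin; zero)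
  open import Data.Fin.Properties using (toℕ<n)
  open import Data.Fin.Subset using (Subset)
  open import Data.List using (List; length)
  open import Data.List.Relation.Unary.All using (All)
  import Data.List.Relation.Unary.All as All
  open import Data.List.Relation.Unary.All.Properties using (map⁺)
  open import Data.Nat using (ℕ; zero; suc; _+_; _*_; _^_; _≤_; z≤n; s≤s; NonZero; >-nonZero)
  open import Data.Nat.Properties
  open import Data.Nat.Tactic.RingSolver using (solve-∀)
  open import Data.Product using (_×_; _,_; proj₁; proj₂)
  open import Data.Rational as ℚ using (1ℚ; _-_)
  open import Data.Vec using (lookup)
  open import Function using (_∘_)
  open import Relation.Binary.PropositionalEquality

  -- With Q = q + b: ε ≤ 1/N₀ leaves every vertex at most n/(10Q) non-neighbours, and c₀Δ ≤ n is
  -- 10Q·M ≤ n for the bound M = (2Q + 10Q²)Δ on the degrees of the union of the cliques.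
  c₀ N₀ : ℕ → ℕ → ℕ
  c₀ q b = 10 * (q + b) * (2 * (q + b) + 10 * ((q + b) * (q + b)))
  N₀ q b = 10 * suc (q + b)

  1≤c₀ : ∀ q {b} → 1 ≤ b → 1 ≤ c₀ q b
  1≤c₀ q {b} 1≤b = *-mono-≤ (*-mono-≤ {1} {10} (s≤s z≤n) 1≤Q) (≤-trans 1≤Q (≤-trans (m≤n*m (q + b) 2) (m≤m+n _ _)))
    where
    1≤Q : 1 ≤ q + b
    1≤Q = ≤-trans 1≤b (m≤n+m b q)

  min-degree⇒few-non-neighbours : ∀ q b {n ε} → ε ℚ.≤ 1/ N₀ q b → (G : Graph n) →
    (∀ v → (1ℚ - ε) ℚ.* ⟦ n ⟧ ℚ.≤ ⟦ degOf (adj G) v ⟧) → ∀ x → 10 * (q + b) * count (not ∘ adj G x) ≤ n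
  min-degree⇒few-non-neighbours q b {n} {ε} ε≤ε₀ G min-degree x =
    ≤-trans (*-monoˡ-≤ (count (not ∘ adj G x)) (*-monoʳ-≤ 10 (n≤1+n (q + b))))
      ([1-ε]n≤d⇒N*c≤n (N₀ q b) ε n (count (adj G x)) _ ε≤ε₀
        (subst (λ d → (1ℚ - ε) ℚ.* ⟦ n ⟧ ℚ.≤ ⟦ d ⟧) (degOf≡count (adj G) x) (min-degree x))
        (count-not (adj G x)))

  module Distribution {q b n : ℕ} (1≤q : 1 ≤ q) (1≤b : 1 ≤ b) (G : Graph n) (H : Hypergraph q n)
    (few-non-neighbours : ∀ x → 10 * (q + b) * count (not ∘ adj G x) ≤ n)
    (c₀Δ≤n : c₀ q b * Δ₁ H ≤ n) where

    A : ℕ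
    A = proj₁ (⌈n/3⌉ n)

    n≤3A : n ≤ 3 * A
    n≤3A = proj₁ (proj₂ (⌈n/3⌉ n))

    open Process G q b (Δ₁ H) A
    open Analysis few-non-neighbours (subst (_≤ n) (*-assoc (10 * Q) (2 * Q + K) (Δ₁ H)) c₀Δ≤n)
                  (proj₂ (proj₂ (⌈n/3⌉ n))) 1≤q

    1≤A : Fin n → 1 ≤ A
    1≤A x = positive (≤-trans (≤-trans (s≤s z≤n) (toℕ<n x)) n≤3A)
      where
      positive : ∀ {a} → 1 ≤ 3 * a → 1 ≤ a
      positive {suc a} _ = s≤s z≤n

    1≤[A^b]^m : ∀ {m} (es : Fin m → Subset n) → (∀ i → count (lookup (es i)) ≡ q) → 1 ≤ (A ^ b) ^ m
    1≤[A^b]^m {zero} _ _ = ≤-refl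
    1≤[A^b]^m {suc m} es size≡q =
      let x , _ = count>0⇒witness (lookup (es zero)) (subst (1 ≤_) (sym (size≡q zero)) 1≤q) in
      m^n>0 (A ^ b) {{m^n≢0 A b {{>-nonZero (1≤A x)}}}} (suc m)

    initial : Invariant (m H) (edge H) (λ _ _ → false)
    initial = invariant-empty (edge H)
      (λ v → subst (_≤ Δ₁ H) (∣tabulate∣≡count (λ i → lookup (edge H i) v)) (maxF-ub _ v))
      (λ i → trans (sym (∣p∣≡count (edge H i))) (uniform H i))

    outs : List (Family (m H) n)
    outs = outcomes (m H) (edge H) (λ _ _ → false)

    length-outs : length outs ≡ (A ^ b) ^ m H
    length-outs = length-outcomes (m H) (edge H) _ initial

    instance
      outs-nonZero : NonZero (length outs)
      outs-nonZero = >-nonZero (subst (1 ≤_) (sym length-outs) (1≤[A^b]^m (edge H) (Invariant.edge-size initial)))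

    distribution : Dist (Family (m H) n)
    distribution = uniformDist outs

    M≤c₀Δ : M ≤ c₀ q b * Δ₁ H
    M≤c₀Δ = subst (M ≤_) (sym (*-assoc (10 * Q) (2 * Q + K) (Δ₁ H)))
                  (m≤n*m M (10 * Q) {{>-nonZero (≤-trans 1≤q (≤-trans (m≤m+n q b) (m≤n*m Q 10)))}})

    sound⇒valid : ∀ {F} → Sound (m H) (edge H) (λ _ _ → false) F →
      ValidFamily b G H F × maxDeg (unionAdj F) ≤ c₀ q b * Δ₁ H
    sound⇒valid {F} S = (Sound.partialK-in-G S , Sound.edge-disjoint S) , ≤-trans (maxF-lub _ degree≤M) M≤c₀Δ
      where
      degree≤M : ∀ v → degOf (unionAdj F) v ≤ M
      degree≤M v = subst (_≤ M) (sym (trans (degOf≡count (unionAdj F) v) (count-cong (unionAdj≡anyᶠ F v))))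
                         (Sound.degree≤M S v)

    distribution-valid : All (λ pF → ValidFamily b G H (proj₂ pF) × maxDeg (unionAdj (proj₂ pF)) ≤ c₀ q b * Δ₁ H)
                             (support distribution)
    distribution-valid = map⁺ (All.map sound⇒valid (outcomes-sound (m H) (edge H) _ initial))

    Event⇒event : ∀ S F → Event H S F ≡ true → event (edge H) S F ≡ true
    Event⇒event S F ev = allᶠ-true _ λ i → allᶠ-true _ λ x → hit i x
      where
      hit : ∀ i x → not (lookup (S i) x) ∨ (lookup (verts (F i)) x ∧ not (lookup (edge H i) x)) ≡ true
      hit i x with lookup (S i) x in x∈S
      ... | false = refl
      ... | true = Event-true H S F ev i x x∈S

    event-count : ∀ S → countᴸ (Event H S) outs * n ^ totalSize S ≤ ((3 * b) ^ b) ^ totalSize S * length outs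
    event-count S = begin
      countᴸ (Event H S) outs * n ^ s   ≤⟨ *-mono-≤ (countᴸ-mono outs (Event⇒event S)) (^-monoˡ-≤ s n≤3A) ⟩
      g * (3 * A) ^ s                   ≡⟨ cong (g *_) (^-distribʳ-* 3 A s) ⟩
      g * (3 ^ s * A ^ s)               ≡⟨ swap g (3 ^ s) (A ^ s) ⟩
      3 ^ s * (g * A ^ s)               ≤⟨ *-monoʳ-≤ (3 ^ s) event-outcomes ⟩
      3 ^ s * (b ^ s * length outs)     ≡⟨ sym (*-assoc (3 ^ s) (b ^ s) (length outs)) ⟩
      3 ^ s * b ^ s * length outs       ≡⟨ cong (_* length outs) (sym (^-distribʳ-* 3 b s)) ⟩
      (3 * b) ^ s * length outs         ≤⟨ *-monoˡ-≤ (length outs) (^-monoˡ-≤ s 3b≤[3b]^b) ⟩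
      ((3 * b) ^ b) ^ s * length outs   ∎
      where
      open ≤-Reasoning
      s : ℕ
      s = totalSize S
      g : ℕ
      g = countᴸ (event (edge H) S) outs
      swap : ∀ a c d → a * (c * d) ≡ c * (a * d)
      swap = solve-∀
      event-outcomes : g * A ^ s ≤ b ^ s * length outs
      event-outcomes = subst₂ (λ t L → g * A ^ t ≤ b ^ t * L) (sym (totalSize≡∑ S)) (sym length-outs)
                       (outcomes-event (m H) (edge H) _ S)
      3b≤[3b]^b : 3 * b ≤ (3 * b) ^ b
      3b≤[3b]^b = subst (_≤ (3 * b) ^ b) (*-identityʳ (3 * b))
                        (^-monoʳ-≤ (3 * b) {{>-nonZero (≤-trans 1≤b (m≤n*m b 3))}} 1≤b)

    Pr-bound : ∀ S → Pr distribution (Event H S) ℚ.* ⟦ n ^ totalSize S ⟧ ℚ.≤ ⟦ ((3 * b) ^ b) ^ totalSize S ⟧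
    Pr-bound S = subst (λ p → p ℚ.* ⟦ n ^ totalSize S ⟧ ℚ.≤ ⟦ ((3 * b) ^ b) ^ totalSize S ⟧)
                       (sym (Pr-uniformDist outs (Event H S)))
                       (g*N≤K*L⇒⟦g⟧/L*⟦N⟧≤⟦K⟧ (countᴸ (Event H S) outs) (n ^ totalSize S) (((3 * b) ^ b) ^ totalSize S)
                                                (length outs) (event-count S))

open import Defs
open import Data.Nat using (ℕ; _≤_; _^_)
open import Data.Nat as ℕ using ()
open import Data.Fin using (Fin)
open import Data.Fin.Subset using (Subset)
open import Data.Product using (Σ; _×_; _,_)
open import Data.List.Relation.Unary.All using (All)
open import Data.Rational as ℚ using (ℚ; _<_; _*_; _-_; 0ℚ; 1ℚ)

open import Data.Nat.Properties using (≤-trans)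
import Data.List.Relation.Unary.All as All
open RationalFacts using (1/_; 1/-pos; ⟦⟧-pos; ⟦c⟧≤C⇒c*Δ≤n; ⟦c⟧≤C⇒⟦k⟧≤C*⟦Δ⟧)
open Construction using (c₀; N₀; 1≤c₀; min-degree⇒few-non-neighbours; module Distribution)

lemma4p5 : (q b : ℕ) → 3 ≤ q → 1 ≤ b →
    Σ ℚ λ ε₀ → Σ ℚ λ C₀ → 0ℚ < ε₀ × 0ℚ < C₀ ×
      ((ε C : ℚ) → 0ℚ < ε → ε ℚ.≤ ε₀ → C₀ ℚ.≤ C →
       (n : ℕ) (G : Graph n) →
       (∀ v → (1ℚ - ε) * ⟦ n ⟧ ℚ.≤ ⟦ degOf (adj G) v ⟧) →
       (H : Hypergraph q n) →
       C * ⟦ Δ₁ H ⟧ ℚ.≤ ⟦ n ⟧ →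
       Σ (Dist (Family (m H) n)) λ D →
         All (λ pF → ValidFamily b G H (Data.Product.proj₂ pF) ×
                     ⟦ maxDeg (unionAdj (Data.Product.proj₂ pF)) ⟧ ℚ.≤ C * ⟦ Δ₁ H ⟧)
             (support D) ×
         ((S : Fin (m H) → Subset n) →
           Pr D (Event H S) * ⟦ n ^ totalSize S ⟧
             ℚ.≤ ⟦ ((3 ℕ.* b) ^ b) ^ totalSize S ⟧))
lemma4p5 q b 3≤q 1≤b = 1/ N₀ q b , ⟦ c₀ q b ⟧ , 1/-pos (N₀ q b) , ⟦⟧-pos (1≤c₀ q 1≤b) ,
  λ ε C _ ε≤ε₀ c₀≤C n G min-degree H CΔ≤n →
    let open Distribution (≤-trans (ℕ.s≤s ℕ.z≤n) 3≤q) 1≤b G H (min-degree⇒few-non-neighbours q b ε≤ε₀ G min-degree)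
                          (⟦c⟧≤C⇒c*Δ≤n (c₀ q b) (Δ₁ H) n C c₀≤C CΔ≤n) in
    distribution ,
    All.map (λ (valid , maxDeg≤c₀Δ) → valid , ⟦c⟧≤C⇒⟦k⟧≤C*⟦Δ⟧ _ (c₀ q b) (Δ₁ H) C maxDeg≤c₀Δ c₀≤C) distribution-valid ,
    Pr-bound
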